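{- Let $\mathbb{F}_q$ be the finite field with $q$ elements and let $s,d\in\mathbb{N}$ with $d<q$ and $1\le s\le d-2$. Fix $\boldsymbol{a}=(a_{d-1},\ldots,a_{d-s})\in\mathbb{F}_q^s$ and let $f_{\boldsymbol{a}}:=T^d+a_{d-1}T^{d-1}+\cdots+a_{d-s}T^{d-s}$. For $\boldsymbol{b}=(b_{d-s-1},\ldots,b_1)\in\mathbb{F}_q^{d-s-1}$ let $f_{\boldsymbol{b}}:=f_{\boldsymbol{a}}+b_{d-s-1}T^{d-s-1}+\cdots+b_1T$, and let $$\mathcal{V}(d,s,\boldsymbol{a}):=\frac{1}{q^{d-s-1}}\sum_{\boldsymbol{b}\in\mathbb{F}_q^{d-s-1}}\mathcal{V}(f_{\boldsymbol{b}}).$$ For each $r$, let $\chi_r^{\boldsymbol{a}}$ be the number of subsets $\mathcal{X}_r\subseteq\mathbb{F}_q$ with exactly $r$ elements such that there exists $g\in\mathbb{F}_q[T]$ of degree at most $d-s-1$ with $(f_{\boldsymbol{a}}+g)(x)=0$ for all $x\in\mathcal{X}_r$. Then $$\mathcal{V}(d,s,\boldsymbol{a})=\sum_{r=1}^{d-s}(-1)^{r-1}\binom{q}{r}q^{1-r}+\frac{1}{q^{d-s-1}}\sum_{r=d-s+1}^{d}(-1)^{r-1}\chi_r^{\boldsymbol{a}}.$$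
   Context: $\mathcal{V}(f):=|\{f(c):c\in\mathbb{F}_q\}|$ denotes the cardinality of the value set of $f\in\mathbb{F}_q[T]$. -}

module Defs where

open import Level using (0ℓ)
open import Data.Nat as ℕ using (ℕ; zero; suc; _∸_; NonZero)
open import Data.Nat.Properties using (m^n≢0)
open import Data.Nat.Combinatorics using (_C_)
open import Data.Nat.ListAction using (sum)
open import Data.Integer as ℤ using (+_)
open import Data.Rational as ℚ using (ℚ; 0ℚ; 1ℚ)
open import Data.List as List using (List; []; _∷_; map; concatMap; filter; length; deduplicate; _++_)
open import Data.List.Relation.Unary.Any as Any using (Any; here; there; any?)
open import Data.List.Relation.Unary.All using (All; all?)
open import Data.List.Relation.Unary.Unique.Propositional using (Unique)
open import Data.List.Membership.Propositional using (_∈_; lose)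
open import Data.List.Membership.Propositional.Properties using (∈-map⁺; ∈-concatMap⁺)
open import Data.Vec as Vec using (Vec; []; _∷_)
open import Data.Product using (∃; _,_)
open import Relation.Nullary using (¬_; Dec; yes; no)
open import Relation.Nullary.Decidable using (_×-dec_) renaming (map′ to mapDec)
open import Relation.Binary.PropositionalEquality using (_≡_; refl)
open import Relation.Binary.Definitions using (DecidableEquality)
open import Algebra.Structures using (IsCommutativeRing)

record FiniteField : Set₁ where
  infixl 7 _*_
  infixl 6 _+_
  field
    Carrier   : Set
    _+_ _*_   : Carrier → Carrier → Carrier
    -_        : Carrier → Carrier
    0# 1#     : Carrier
    isCommutativeRing : IsCommutativeRing _≡_ _+_ _*_ -_ 0# 1#
    0≢1       : ¬ (0# ≡ 1#)
    inverse   : ∀ x → ¬ (x ≡ 0#) → ∃ λ y → x * y ≡ 1#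
    _≟_       : DecidableEquality Carrier
    elements  : List Carrier
    unique    : Unique elements
    complete  : ∀ x → x ∈ elements

  q : ℕ
  q = length elements

  _^_ : Carrier → ℕ → Carrier
  x ^ zero  = 1#
  x ^ suc n = x * (x ^ n)

  evalDesc : ∀ {n} → Vec Carrier n → ℕ → Carrier → Carrier
  evalDesc []       e x = 0#
  evalDesc (c ∷ cs) e x = c * (x ^ e) + evalDesc cs (e ∸ 1) x

  allVecs : (n : ℕ) → List (Vec Carrier n)
  allVecs zero    = [] ∷ []
  allVecs (suc n) = concatMap (λ x → map (x ∷_) (allVecs n)) elements

  allVecs-complete : ∀ {n} (v : Vec Carrier n) → v ∈ allVecs n
  allVecs-complete []      = here refl
  allVecs-complete (x ∷ v) =
    ∈-concatMap⁺ (λ y → map (y ∷_) (allVecs _)) (Any.map (λ { refl → ∈-map⁺ (x ∷_) (allVecs-complete v) }) (complete x))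

  valueSetSize : (Carrier → Carrier) → ℕ
  valueSetSize f = length (deduplicate _≟_ (map f elements))

  -- All sublists of a list; for the duplicate-free complete list `elements`
  -- these are exactly the subsets of F_q (each listed once).
  sublists : List Carrier → List (List Carrier)
  sublists []       = [] ∷ []
  sublists (x ∷ xs) = map (x ∷_) (sublists xs) ++ sublists xs

  subsetsOfSize : ℕ → List (List Carrier)
  subsetsOfSize r = filter (λ X → length X ℕ.≟ r) (sublists elements)

  module _ (d s : ℕ) where

    fa : Vec Carrier s → Carrier → Carrier
    fa a x = x ^ d + evalDesc a (d ∸ 1) x

    fb : Vec Carrier s → Vec Carrier (d ∸ s ∸ 1) → Carrier → Carrier
    fb a b x = fa a x + evalDesc b (d ∸ s ∸ 1) x

    -- X ⊆ F_q admits g ∈ F_q[T] with deg g ≤ d-s-1 and (f_a + g)(x) = 0 on X;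
    -- g = c_{d-s-1} T^{d-s-1} + … + c_0, c = (c_{d-s-1},…,c_0).
    Vanishes : Vec Carrier s → List Carrier → Set
    Vanishes a X = ∃ λ (c : Vec Carrier (d ∸ s)) →
                     All (λ x → fa a x + evalDesc c (d ∸ s ∸ 1) x ≡ 0#) X

    vanishes? : (a : Vec Carrier s) (X : List Carrier) → Dec (Vanishes a X)
    vanishes? a X =
      mapDec Any.satisfied (λ { (c , p) → lose (allVecs-complete c) p })
        (any? (λ c → all? (λ x → (fa a x + evalDesc c (d ∸ s ∸ 1) x) ≟ 0#) X)
              (allVecs (d ∸ s)))

    χ : Vec Carrier s → ℕ → ℕ
    χ a r = length (filter (vanishes? a) (subsetsOfSize r))

  q-nonZero : NonZero q
  q-nonZero = helper elements (complete 0#)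
    where
      helper : (xs : List Carrier) → 0# ∈ xs → NonZero (length xs)
      helper (_ ∷ _) _ = _

  invPowQ : ℕ → ℚ
  invPowQ k = (+ 1) ℚ./ (q ℕ.^ k)
    where instance _ = m^n≢0 q k {{q-nonZero}}

  avgValueSet : (d s : ℕ) → Vec Carrier s → ℚ
  avgValueSet d s a =
    invPowQ (d ∸ s ∸ 1) ℚ.*
      ((+ sum (map (λ b → valueSetSize (fb d s a b)) (allVecs (d ∸ s ∸ 1)))) ℚ./ 1)

signQ : ℕ → ℚ
signQ zero    = 1ℚ
signQ (suc n) = ℚ.- signQ n

ℕtoℚ : ℕ → ℚ
ℕtoℚ n = (+ n) ℚ./ 1

-- Σ_{r=m}^{n} f r  (empty, i.e. 0, if n < m)
sumFromTo : ℕ → ℕ → (ℕ → ℚ) → ℚ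
sumFromTo m n f = go (suc n ∸ m) m
  where
    go : ℕ → ℕ → ℚ
    go zero    _ = 0ℚ
    go (suc k) i = f i ℚ.+ go k (suc i)

-- By inclusion–exclusion, [v ∈ f_b(F_q)] = 1 - Σ_{X ⊆ F_q} (-1)^|X| [f_b = v on X].  Summing over v and b,
-- the pair (b, -v) is the coefficient vector of a polynomial g of degree < n = d - s, and "f_b = v on X"
-- becomes "f_a + g = 0 on X"; hence Σ_b 𝒱(f_b) = q^n - Σ_X (-1)^|X| N(X), where N(X) counts these g.
-- By Lagrange interpolation N(X) = q^(n-|X|) when |X| ≤ n; when |X| ≥ n there is at most one such g, so
-- N(X) is the indicator counted by χ; and N(X) = 0 when |X| > d, as f_a + g is monic of degree d.
-- Grouping the subsets X by size, the terms with X = ∅ cancel and the rest give the formula.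

module Submission where

open import Defs
open import Algebra.Bundles using (CommutativeRing)
open import Data.Bool using (if_then_else_; true; false)
open import Data.Empty using (⊥-elim)
import Data.Integer as ℤ
import Data.Integer.Tactic.RingSolver as ℤ-Solver
open import Data.List using (List; []; _∷_; _++_; map; concatMap; cartesianProductWith; filter; length; deduplicate)
open import Data.List.Membership.Propositional using (_∈_; _∉_; find; lose)
import Data.List.Membership.Propositional.Properties as ∈
open import Data.List.Membership.Propositional.Properties.WithK using (unique∧set⇒bag)
open import Data.List.Relation.Binary.BagAndSetEquality using (∼bag⇒↭)
open import Data.List.Relation.Binary.Permutation.Propositional using (_↭_; refl; prep; swap; trans)
open import Data.List.Relation.Unary.All as All using (All; all?; []; _∷_)
open import Data.List.Relation.Unary.AllPairs using ([]; _∷_)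
open import Data.List.Relation.Unary.Any using (here; there; any?)
open import Data.List.Relation.Unary.Unique.Propositional using (Unique)
import Data.List.Relation.Unary.Unique.Propositional.Properties as Unique
open import Data.Nat as ℕ using (ℕ; zero; suc; _∸_; _≤_; _<_; NonZero)
open import Data.Nat.Combinatorics using (_C_; nCk+nC[k+1]≡[n+1]C[k+1])
open import Data.Nat.ListAction using (sum)
import Data.Nat.Properties as ℕ
open import Data.Product using (∃; _×_; _,_; proj₁; proj₂)
open import Data.Rational as ℚ using (ℚ; 0ℚ; 1ℚ; _+_; _*_; -_; toℚᵘ)
import Data.Rational.Properties as ℚ
import Data.Rational.Unnormalised as ℚᵘ
import Data.Rational.Unnormalised.Properties as ℚᵘ
open import Data.Sum using (_⊎_; inj₁; inj₂)
open import Data.Vec using (Vec; []; _∷_; _∷ʳ_)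
import Data.Vec as Vec using (_++_; replicate)
import Data.Vec.Properties as Vec using (∷-injective; ≡-dec)
open import Function using (_∘_)
open import Function.Bundles using (mk⇔)
open import Relation.Binary.PropositionalEquality using (_≡_; refl; sym; cong; cong₂; subst; module ≡-Reasoning)
  renaming (trans to ≡-trans)
open import Relation.Nullary using (Dec; yes; no; does; ¬_)
open import Relation.Nullary.Decidable using (_×-dec_; dec⇒maybe)
open import Tactic.RingSolver using (solve-∀)
open import Tactic.RingSolver.Core.AlmostCommutativeRing using (AlmostCommutativeRing; fromCommutativeRing)

open ≡-Reasoning

ℚ-ring : AlmostCommutativeRing _ _
ℚ-ring = fromCommutativeRing ℚ.+-*-commutativeRing (λ x → dec⇒maybe (0ℚ ℚ.≟ x))

ℕtoℚ≃mkℚᵘ : ∀ n → toℚᵘ (ℕtoℚ n) ℚᵘ.≃ ℚᵘ.mkℚᵘ (ℤ.+ n) 0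
ℕtoℚ≃mkℚᵘ n = ℚ.toℚᵘ-fromℚᵘ (ℚᵘ.mkℚᵘ (ℤ.+ n) 0)

ℕtoℚ-suc : ∀ n → ℕtoℚ (suc n) ≡ 1ℚ + ℕtoℚ n
ℕtoℚ-suc n = ℚ.toℚᵘ-injective (ℚᵘ.≃-trans (ℕtoℚ≃mkℚᵘ (suc n)) (ℚᵘ.≃-sym
  (ℚᵘ.≃-trans (ℚ.toℚᵘ-homo-+ 1ℚ (ℕtoℚ n))
  (ℚᵘ.≃-trans (ℚᵘ.+-cong (ℕtoℚ≃mkℚᵘ 1) (ℕtoℚ≃mkℚᵘ n)) (ℚᵘ.*≡* (identity (ℤ.+ n)))))))
  where
  identity : ∀ x → (ℤ.1ℤ ℤ.* ℤ.1ℤ ℤ.+ x ℤ.* ℤ.1ℤ) ℤ.* ℤ.1ℤ ≡ (ℤ.1ℤ ℤ.+ x) ℤ.* (ℤ.1ℤ ℤ.* ℤ.1ℤ)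
  identity = ℤ-Solver.solve-∀

ℕtoℚ-+ : ∀ m n → ℕtoℚ (m ℕ.+ n) ≡ ℕtoℚ m + ℕtoℚ n
ℕtoℚ-+ zero    n = sym (ℚ.+-identityˡ (ℕtoℚ n))
ℕtoℚ-+ (suc m) n = begin
  ℕtoℚ (suc (m ℕ.+ n))        ≡⟨ ℕtoℚ-suc (m ℕ.+ n) ⟩
  1ℚ + ℕtoℚ (m ℕ.+ n)         ≡⟨ cong (1ℚ +_) (ℕtoℚ-+ m n) ⟩
  1ℚ + (ℕtoℚ m + ℕtoℚ n)      ≡⟨ ℚ.+-assoc 1ℚ (ℕtoℚ m) (ℕtoℚ n) ⟨
  (1ℚ + ℕtoℚ m) + ℕtoℚ n      ≡⟨ cong (_+ ℕtoℚ n) (ℕtoℚ-suc m) ⟨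
  ℕtoℚ (suc m) + ℕtoℚ n       ∎

ℕtoℚ-* : ∀ m n → ℕtoℚ (m ℕ.* n) ≡ ℕtoℚ m * ℕtoℚ n
ℕtoℚ-* zero    n = sym (ℚ.*-zeroˡ (ℕtoℚ n))
ℕtoℚ-* (suc m) n = begin
  ℕtoℚ (n ℕ.+ m ℕ.* n)        ≡⟨ ℕtoℚ-+ n (m ℕ.* n) ⟩
  ℕtoℚ n + ℕtoℚ (m ℕ.* n)     ≡⟨ cong (ℕtoℚ n +_) (ℕtoℚ-* m n) ⟩
  ℕtoℚ n + ℕtoℚ m * ℕtoℚ n    ≡⟨ identity (ℕtoℚ m) (ℕtoℚ n) ⟩
  (1ℚ + ℕtoℚ m) * ℕtoℚ n      ≡⟨ cong (_* ℕtoℚ n) (ℕtoℚ-suc m) ⟨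
  ℕtoℚ (suc m) * ℕtoℚ n       ∎
  where
  identity : ∀ x y → y + x * y ≡ (1ℚ + x) * y
  identity = solve-∀ ℚ-ring

1/[m*n]*n≡1/m : ∀ m n .{{_ : NonZero m}} .{{_ : NonZero n}} .{{_ : NonZero (m ℕ.* n)}} →
                ((ℤ.+ 1) ℚ./ (m ℕ.* n)) * ℕtoℚ n ≡ (ℤ.+ 1) ℚ./ m
1/[m*n]*n≡1/m (suc m) (suc n) = ℚ.toℚᵘ-injective
  (ℚᵘ.≃-trans (ℚ.toℚᵘ-homo-* ((ℤ.+ 1) ℚ./ (suc m ℕ.* suc n)) (ℕtoℚ (suc n)))
  (ℚᵘ.≃-trans (ℚᵘ.*-cong (1/≃ (n ℕ.+ m ℕ.* suc n)) (ℕtoℚ≃mkℚᵘ (suc n)))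
  (ℚᵘ.≃-trans (ℚᵘ.*≡* (identity (ℤ.+ suc m) (ℤ.+ suc n))) (ℚᵘ.≃-sym (1/≃ m)))))
  where
  1/≃ : ∀ k → toℚᵘ ((ℤ.+ 1) ℚ./ suc k) ℚᵘ.≃ ℚᵘ.mkℚᵘ (ℤ.+ 1) k
  1/≃ k = ℚ.toℚᵘ-fromℚᵘ (ℚᵘ.mkℚᵘ (ℤ.+ 1) k)
  identity : ∀ x y → (ℤ.1ℤ ℤ.* y) ℤ.* x ≡ ℤ.1ℤ ℤ.* ((x ℤ.* y) ℤ.* ℤ.1ℤ)
  identity = ℤ-Solver.solve-∀

-signQ[1+r]*x≡signQ[r]*x : ∀ r x → - (signQ (suc r) * x) ≡ signQ r * x
-signQ[1+r]*x≡signQ[r]*x r x = identity (signQ r) x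
  where
  identity : ∀ u w → - (- u * w) ≡ u * w
  identity = solve-∀ ℚ-ring

when : {P : Set} → Dec P → ℚ → ℚ
when d v = if does d then v else 0ℚ

when-yes : {P : Set} (d : Dec P) (v : ℚ) → P → when d v ≡ v
when-yes (yes _) v _ = refl
when-yes (no ¬p) v p = ⊥-elim (¬p p)

when-no : {P : Set} (d : Dec P) (v : ℚ) → ¬ P → when d v ≡ 0ℚ
when-no (yes p) v ¬p = ⊥-elim (¬p p)
when-no (no _)  v _  = refl

when-cong : {P Q : Set} (dp : Dec P) (dq : Dec Q) (v : ℚ) → (P → Q) → (Q → P) → when dp v ≡ when dq v
when-cong (yes p) dq      v p⇒q _   = sym (when-yes dq v (p⇒q p))
when-cong (no ¬p) (yes q) v _   q⇒p = ⊥-elim (¬p (q⇒p q))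
when-cong (no _)  (no _)  v _   _   = refl

when-×-dec : {P Q : Set} (dp : Dec P) (dq : Dec Q) (v : ℚ) → when (dp ×-dec dq) v ≡ when dp (when dq v)
when-×-dec dp dq v with does dp
... | true  = refl
... | false = refl

∑ : {A : Set} → List A → (A → ℚ) → ℚ
∑ []       f = 0ℚ
∑ (x ∷ xs) f = f x + ∑ xs f

-- The body of ∑[ x ← xs ] e extends over _*_ but not over _+_.
infixr 6.5 ∑
syntax ∑ xs (λ x → e) = ∑[ x ← xs ] e

module _ {A : Set} where

  ∑-cong-∈ : (xs : List A) {f g : A → ℚ} → (∀ x → x ∈ xs → f x ≡ g x) → ∑ xs f ≡ ∑ xs g
  ∑-cong-∈ []       f≗g = refl
  ∑-cong-∈ (x ∷ xs) f≗g = cong₂ _+_ (f≗g x (here refl)) (∑-cong-∈ xs (λ y y∈ → f≗g y (there y∈)))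

  ∑-cong : (xs : List A) {f g : A → ℚ} → (∀ x → f x ≡ g x) → ∑ xs f ≡ ∑ xs g
  ∑-cong xs f≗g = ∑-cong-∈ xs (λ x _ → f≗g x)

  ∑-zero : (xs : List A) → ∑[ _ ← xs ] 0ℚ ≡ 0ℚ
  ∑-zero []       = refl
  ∑-zero (x ∷ xs) = ≡-trans (ℚ.+-identityˡ _) (∑-zero xs)

  ∑-vanishes : (xs : List A) (f : A → ℚ) → (∀ x → x ∈ xs → f x ≡ 0ℚ) → ∑ xs f ≡ 0ℚ
  ∑-vanishes xs f f≡0 = ≡-trans (∑-cong-∈ xs f≡0) (∑-zero xs)

  ∑-++ : (xs ys : List A) (f : A → ℚ) → ∑ (xs ++ ys) f ≡ ∑ xs f + ∑ ys f
  ∑-++ []       ys f = sym (ℚ.+-identityˡ _)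
  ∑-++ (x ∷ xs) ys f = ≡-trans (cong (f x +_) (∑-++ xs ys f)) (sym (ℚ.+-assoc (f x) _ _))

  ∑-+ : (xs : List A) (f g : A → ℚ) → ∑[ x ← xs ] (f x + g x) ≡ ∑ xs f + ∑ xs g
  ∑-+ []       f g = refl
  ∑-+ (x ∷ xs) f g = ≡-trans (cong ((f x + g x) +_) (∑-+ xs f g)) (interchange (f x) (g x) _ _)
    where
    interchange : ∀ a b c d → (a + b) + (c + d) ≡ (a + c) + (b + d)
    interchange = solve-∀ ℚ-ring

  ∑-*ˡ : (xs : List A) (c : ℚ) (f : A → ℚ) → ∑[ x ← xs ] (c * f x) ≡ c * ∑ xs f
  ∑-*ˡ []       c f = sym (ℚ.*-zeroʳ c)
  ∑-*ˡ (x ∷ xs) c f = ≡-trans (cong (c * f x +_) (∑-*ˡ xs c f)) (sym (ℚ.*-distribˡ-+ c (f x) _))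

  ∑-neg : (xs : List A) (f : A → ℚ) → ∑[ x ← xs ] (- f x) ≡ - ∑ xs f
  ∑-neg []       f = refl
  ∑-neg (x ∷ xs) f = ≡-trans (cong (- f x +_) (∑-neg xs f)) (sym (ℚ.neg-distrib-+ (f x) _))

  ∑-+-neg : (xs : List A) (f g : A → ℚ) → ∑[ x ← xs ] (f x + - g x) ≡ ∑ xs f + - ∑ xs g
  ∑-+-neg xs f g = ≡-trans (∑-+ xs f (λ x → - g x)) (cong (∑ xs f +_) (∑-neg xs g))

  ∑-const : (xs : List A) (c : ℚ) → ∑[ _ ← xs ] c ≡ ℕtoℚ (length xs) * c
  ∑-const []       c = sym (ℚ.*-zeroˡ c)
  ∑-const (x ∷ xs) c = begin
    c + ∑[ _ ← xs ] c               ≡⟨ cong (c +_) (∑-const xs c) ⟩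
    c + ℕtoℚ (length xs) * c        ≡⟨ identity (ℕtoℚ (length xs)) c ⟩
    (1ℚ + ℕtoℚ (length xs)) * c     ≡⟨ cong (_* c) (ℕtoℚ-suc (length xs)) ⟨
    ℕtoℚ (suc (length xs)) * c      ∎
    where
    identity : ∀ x y → y + x * y ≡ (1ℚ + x) * y
    identity = solve-∀ ℚ-ring

  length≡∑1 : (xs : List A) → ℕtoℚ (length xs) ≡ ∑[ _ ← xs ] 1ℚ
  length≡∑1 xs = sym (≡-trans (∑-const xs 1ℚ) (ℚ.*-identityʳ _))

  ∑-when : {P : Set} (d : Dec P) (xs : List A) (f : A → ℚ) → ∑[ x ← xs ] when d (f x) ≡ when d (∑ xs f)
  ∑-when (yes _) xs f = refl
  ∑-when (no _)  xs f = ∑-zero xs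

  ∑-filter : {P : A → Set} (P? : ∀ x → Dec (P x)) (xs : List A) (f : A → ℚ) →
             ∑ (filter P? xs) f ≡ ∑[ x ← xs ] when (P? x) (f x)
  ∑-filter P? []       f = refl
  ∑-filter P? (x ∷ xs) f with does (P? x)
  ... | true  = cong (f x +_) (∑-filter P? xs f)
  ... | false = ≡-trans (∑-filter P? xs f) (sym (ℚ.+-identityˡ _))

  ∑-↭ : {xs ys : List A} → xs ↭ ys → (f : A → ℚ) → ∑ xs f ≡ ∑ ys f
  ∑-↭ refl          f = refl
  ∑-↭ (prep x xs↭ys) f = cong (f x +_) (∑-↭ xs↭ys f)
  ∑-↭ (swap x y xs↭ys) f = ≡-trans (cong (λ s → f x + (f y + s)) (∑-↭ xs↭ys f)) (exchange (f x) (f y) _)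
    where
    exchange : ∀ a b c → a + (b + c) ≡ b + (a + c)
    exchange = solve-∀ ℚ-ring
  ∑-↭ (trans xs↭ys ys↭zs) f = ≡-trans (∑-↭ xs↭ys f) (∑-↭ ys↭zs f)

  ∑-unique-set : (xs ys : List A) (f : A → ℚ) → Unique xs → Unique ys →
                 (∀ {z} → z ∈ xs → z ∈ ys) → (∀ {z} → z ∈ ys → z ∈ xs) → ∑ xs f ≡ ∑ ys f
  ∑-unique-set xs ys f !xs !ys xs⊆ys ys⊆xs =
    ∑-↭ (∼bag⇒↭ (unique∧set⇒bag !xs !ys (mk⇔ xs⊆ys ys⊆xs))) f

  ∑-delta : (_≟_ : (x y : A) → Dec (x ≡ y)) (xs : List A) (c : A) (v : ℚ) →
            Unique xs → c ∈ xs → ∑[ x ← xs ] when (x ≟ c) v ≡ v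
  ∑-delta _≟_ (x ∷ xs) c v (x∉xs ∷ !xs) c∈ with x ≟ c | c∈
  ... | yes refl | _ = begin
    v + ∑[ y ← xs ] when (y ≟ x) v   ≡⟨ cong (v +_) (∑-vanishes xs _ (λ y y∈ → when-no (y ≟ x) v
                                          (λ { refl → All.lookup x∉xs y∈ refl }))) ⟩
    v + 0ℚ                           ≡⟨ ℚ.+-identityʳ v ⟩
    v                                ∎
  ... | no x≢c | here c≡x   = ⊥-elim (x≢c (sym c≡x))
  ... | no _   | there c∈xs = ≡-trans (ℚ.+-identityˡ _) (∑-delta _≟_ xs c v !xs c∈xs)

module _ {A B : Set} where

  ∑-map : (h : A → B) (xs : List A) (f : B → ℚ) → ∑ (map h xs) f ≡ ∑[ x ← xs ] f (h x)
  ∑-map h []       f = refl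
  ∑-map h (x ∷ xs) f = cong (f (h x) +_) (∑-map h xs f)

  ∑-concatMap : (h : A → List B) (xs : List A) (f : B → ℚ) →
                ∑ (concatMap h xs) f ≡ ∑[ x ← xs ] ∑ (h x) f
  ∑-concatMap h []       f = refl
  ∑-concatMap h (x ∷ xs) f = ≡-trans (∑-++ (h x) (concatMap h xs) f) (cong (∑ (h x) f +_) (∑-concatMap h xs f))

  ∑-comm : (xs : List A) (ys : List B) (f : A → B → ℚ) →
           ∑[ x ← xs ] ∑[ y ← ys ] f x y ≡ ∑[ y ← ys ] ∑[ x ← xs ] f x y
  ∑-comm []       ys f = sym (∑-zero ys)
  ∑-comm (x ∷ xs) ys f = ≡-trans (cong (∑ ys (f x) +_) (∑-comm xs ys f)) (sym (∑-+ ys (f x) _))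

∑-bijection : {A : Set} (xs : List A) → Unique xs → (∀ x → x ∈ xs) →
              (σ τ : A → A) → (∀ x → τ (σ x) ≡ x) → (∀ x → σ (τ x) ≡ x) →
              (f : A → ℚ) → ∑[ x ← xs ] f (σ x) ≡ ∑ xs f
∑-bijection xs !xs complete σ τ τσ στ f = ≡-trans (sym (∑-map σ xs f))
  (∑-unique-set (map σ xs) xs f (Unique.map⁺ σ-injective !xs) !xs (λ _ → complete _)
     (λ {z} _ → subst (_∈ map σ xs) (στ z) (∈.∈-map⁺ σ (complete (τ z)))))
  where
  σ-injective : ∀ {x y} → σ x ≡ σ y → x ≡ y
  σ-injective {x} {y} σx≡σy = ≡-trans (sym (τσ x)) (≡-trans (cong τ σx≡σy) (τσ y))

ℕtoℚ-sum : {A : Set} (xs : List A) (g : A → ℕ) → ℕtoℚ (sum (map g xs)) ≡ ∑[ x ← xs ] ℕtoℚ (g x)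
ℕtoℚ-sum []       g = refl
ℕtoℚ-sum (x ∷ xs) g = ≡-trans (ℕtoℚ-+ (g x) _) (cong (ℕtoℚ (g x) +_) (ℕtoℚ-sum xs g))

range : ℕ → ℕ → List ℕ
range i zero    = []
range i (suc k) = i ∷ range (suc i) k

range-++ : ∀ i a b → range i (a ℕ.+ b) ≡ range i a ++ range (i ℕ.+ a) b
range-++ i zero    b rewrite ℕ.+-identityʳ i = refl
range-++ i (suc a) b rewrite ℕ.+-suc i a = cong (i ∷_) (range-++ (suc i) a b)

∈-range⁻ : ∀ {i k r} → r ∈ range i k → i ≤ r × r < i ℕ.+ k
∈-range⁻ {i} {suc k} (here refl) = ℕ.≤-refl , ℕ.m<m+n i ℕ.z<s
∈-range⁻ {i} {suc k} {r} (there r∈) with ∈-range⁻ r∈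
... | i<r , r<1+i+k = ℕ.<⇒≤ i<r , subst (r <_) (sym (ℕ.+-suc i k)) r<1+i+k

∈-range⁺ : ∀ {i k r} → i ≤ r → r < i ℕ.+ k → r ∈ range i k
∈-range⁺ {i} {zero}  i≤r r<i+0 = ⊥-elim (ℕ.<-irrefl refl (ℕ.≤-<-trans i≤r (subst (_ <_) (ℕ.+-identityʳ i) r<i+0)))
∈-range⁺ {i} {suc k} {r} i≤r r<i+1+k with i ℕ.≟ r
... | yes refl = here refl
... | no i≢r   = there (∈-range⁺ (ℕ.≤∧≢⇒< i≤r i≢r) (subst (r <_) (ℕ.+-suc i k) r<i+1+k))

range-unique : ∀ i k → Unique (range i k)
range-unique i zero    = []
range-unique i (suc k) = All.tabulate (λ r∈ i≡r → ℕ.<-irrefl i≡r (proj₁ (∈-range⁻ r∈))) ∷ range-unique (suc i) k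

sumFromTo-step : ∀ i n (f : ℕ → ℚ) → i ≤ n → sumFromTo i n f ≡ f i + sumFromTo (suc i) n f
sumFromTo-step i n f i≤n rewrite ℕ.+-∸-assoc 1 i≤n = refl

sumFromTo-empty : ∀ i n (f : ℕ → ℚ) → n < i → sumFromTo i n f ≡ 0ℚ
sumFromTo-empty i n f n<i rewrite ℕ.m≤n⇒m∸n≡0 n<i = refl

sumFromTo≡∑range : ∀ i n (f : ℕ → ℚ) → sumFromTo i n f ≡ ∑ (range i (suc n ∸ i)) f
sumFromTo≡∑range i n f = go (suc n ∸ i) i refl
  where
  go : ∀ k i → suc n ∸ i ≡ k → sumFromTo i n f ≡ ∑ (range i k) f
  go zero    i n<i = sumFromTo-empty i n f (ℕ.m∸n≡0⇒m≤n n<i)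
  go (suc k) i eq with i ℕ.≤? n
  ... | yes i≤n = ≡-trans (sumFromTo-step i n f i≤n)
                    (cong (f i +_) (go k (suc i) (ℕ.suc-injective (≡-trans (sym (ℕ.+-∸-assoc 1 i≤n)) eq))))
  ... | no i≰n  with () ← ≡-trans (sym eq) (ℕ.m≤n⇒m∸n≡0 (ℕ.≰⇒> i≰n))

∑-bySize : {A : Set} (K : ℕ) (Xs : List (List A)) (φ : List A → ℚ) → (∀ X → X ∈ Xs → length X ≤ K) →
           ∑ Xs φ ≡ ∑[ r ← range 0 (suc K) ] ∑ (filter (λ X → length X ℕ.≟ r) Xs) φ
∑-bySize K Xs φ bounded = sym (begin
  ∑[ r ← range 0 (suc K) ] ∑ (filter (λ X → length X ℕ.≟ r) Xs) φ
    ≡⟨ ∑-cong (range 0 (suc K)) (λ r → ∑-filter (λ X → length X ℕ.≟ r) Xs φ) ⟩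
  ∑[ r ← range 0 (suc K) ] ∑[ X ← Xs ] when (length X ℕ.≟ r) (φ X)
    ≡⟨ ∑-comm (range 0 (suc K)) Xs (λ r X → when (length X ℕ.≟ r) (φ X)) ⟩
  ∑[ X ← Xs ] ∑[ r ← range 0 (suc K) ] when (length X ℕ.≟ r) (φ X)
    ≡⟨ ∑-cong-∈ Xs (λ X X∈ → ≡-trans
         (∑-cong (range 0 (suc K)) (λ r → when-cong (length X ℕ.≟ r) (r ℕ.≟ length X) (φ X) sym sym))
         (∑-delta ℕ._≟_ (range 0 (suc K)) (length X) (φ X) (range-unique 0 (suc K))
            (∈-range⁺ ℕ.z≤n (ℕ.s≤s (bounded X X∈))))) ⟩
  ∑ Xs φ ∎)

All-map-∈ : {A : Set} {P Q : A → Set} {xs : List A} → (∀ {x} → x ∈ xs → P x → Q x) → All P xs → All Q xs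
All-map-∈ P⇒Q ps = All.tabulate (λ x∈ → P⇒Q x∈ (All.lookup ps x∈))

module _ (F : FiniteField) where

  open FiniteField F using (Carrier; 0#; 1#; isCommutativeRing; 0≢1; inverse; elements; unique; complete; q;
    evalDesc; allVecs; allVecs-complete; valueSetSize; sublists; subsetsOfSize; fa; fb; Vanishes; vanishes?; χ;
    invPowQ)
    renaming (_+_ to _⊕_; _*_ to _⊗_; -_ to ⊖_; _^_ to _^F_; _≟_ to _≟F_)

  private
    ring : CommutativeRing _ _
    ring = record { isCommutativeRing = isCommutativeRing }

  open CommutativeRing ring using (+-assoc; +-identityˡ; +-identityʳ; -‿inverseʳ;
    *-assoc; *-comm; *-identityˡ; *-identityʳ; zeroˡ; zeroʳ; distribˡ; distribʳ; +-group)
  open import Algebra.Properties.Group +-group using (//-rightDividesˡ; \\-leftDividesˡ; \\-leftDividesʳ;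
    ⁻¹-involutive; x∙y⁻¹≈ε⇒x≈y; inverseʳ-unique; quasigroup)
  open import Algebra.Properties.Quasigroup quasigroup using (x≈z//y)
  open import Algebra.Properties.Ring (CommutativeRing.ring ring) using (-‿distribˡ-*)
  open import Data.List.Relation.Unary.Unique.DecPropositional.Properties _≟F_ using (deduplicate-!)

  x≡z-y⇒x+y≡z : ∀ x y z → x ≡ z ⊕ ⊖ y → x ⊕ y ≡ z
  x≡z-y⇒x+y≡z x y z x≡z-y = ≡-trans (cong (_⊕ y) x≡z-y) (//-rightDividesˡ y z)

  x≢y⇒x-y≢0 : ∀ x y → ¬ x ≡ y → ¬ x ⊕ ⊖ y ≡ 0#
  x≢y⇒x-y≢0 x y x≢y x-y≡0 = x≢y (x∙y⁻¹≈ε⇒x≈y x y x-y≡0)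

  _⁻¹ : Carrier → Carrier
  x ⁻¹ with x ≟F 0#
  ... | yes _  = 0#
  ... | no x≢0 = proj₁ (inverse x x≢0)

  x*x⁻¹≡1 : ∀ x → ¬ x ≡ 0# → x ⊗ x ⁻¹ ≡ 1#
  x*x⁻¹≡1 x x≢0 with x ≟F 0#
  ... | yes x≡0 = ⊥-elim (x≢0 x≡0)
  ... | no x≢0  = proj₂ (inverse x x≢0)

  a*p+b≡c⇒p≡[c-b]/a : ∀ a p b c → ¬ a ≡ 0# → a ⊗ p ⊕ b ≡ c → p ≡ (c ⊕ ⊖ b) ⊗ a ⁻¹
  a*p+b≡c⇒p≡[c-b]/a a p b c a≢0 a*p+b≡c = begin
    p                   ≡⟨ *-identityʳ p ⟨
    p ⊗ 1#              ≡⟨ cong (p ⊗_) (x*x⁻¹≡1 a a≢0) ⟨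
    p ⊗ (a ⊗ a ⁻¹)      ≡⟨ *-assoc p a (a ⁻¹) ⟨
    (p ⊗ a) ⊗ a ⁻¹      ≡⟨ cong (_⊗ a ⁻¹) (*-comm p a) ⟩
    (a ⊗ p) ⊗ a ⁻¹      ≡⟨ cong (_⊗ a ⁻¹) (x≈z//y (a ⊗ p) b c a*p+b≡c) ⟩
    (c ⊕ ⊖ b) ⊗ a ⁻¹    ∎

  p≡[c-b]/a⇒a*p+b≡c : ∀ a p b c → ¬ a ≡ 0# → p ≡ (c ⊕ ⊖ b) ⊗ a ⁻¹ → a ⊗ p ⊕ b ≡ c
  p≡[c-b]/a⇒a*p+b≡c a p b c a≢0 refl = x≡z-y⇒x+y≡z (a ⊗ p) b c (begin
    a ⊗ ((c ⊕ ⊖ b) ⊗ a ⁻¹)     ≡⟨ cong (a ⊗_) (*-comm (c ⊕ ⊖ b) (a ⁻¹)) ⟩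
    a ⊗ (a ⁻¹ ⊗ (c ⊕ ⊖ b))     ≡⟨ *-assoc a (a ⁻¹) _ ⟨
    (a ⊗ a ⁻¹) ⊗ (c ⊕ ⊖ b)     ≡⟨ cong (_⊗ (c ⊕ ⊖ b)) (x*x⁻¹≡1 a a≢0) ⟩
    1# ⊗ (c ⊕ ⊖ b)             ≡⟨ *-identityˡ _ ⟩
    c ⊕ ⊖ b                    ∎)

  -- Polynomials and synthetic division

  eval : ∀ {k} → Vec Carrier k → Carrier → Carrier
  eval {k} c z = evalDesc c (k ∸ 1) z

  evalDesc-∷ʳ : ∀ {j} (b : Vec Carrier j) e w z → evalDesc (b ∷ʳ w) e z ≡ evalDesc b e z ⊕ w ⊗ (z ^F (e ∸ j))
  evalDesc-∷ʳ []       e w z = ≡-trans (+-identityʳ _) (sym (+-identityˡ _))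
  evalDesc-∷ʳ {suc j} (b₀ ∷ b) e w z = begin
    b₀ ⊗ (z ^F e) ⊕ evalDesc (b ∷ʳ w) (e ∸ 1) z
      ≡⟨ cong (b₀ ⊗ (z ^F e) ⊕_) (evalDesc-∷ʳ b (e ∸ 1) w z) ⟩
    b₀ ⊗ (z ^F e) ⊕ (evalDesc b (e ∸ 1) z ⊕ w ⊗ (z ^F (e ∸ 1 ∸ j)))
      ≡⟨ +-assoc _ _ _ ⟨
    (b₀ ⊗ (z ^F e) ⊕ evalDesc b (e ∸ 1) z) ⊕ w ⊗ (z ^F (e ∸ 1 ∸ j))
      ≡⟨ cong (λ k → (b₀ ⊗ (z ^F e) ⊕ evalDesc b (e ∸ 1) z) ⊕ w ⊗ (z ^F k)) (ℕ.∸-+-assoc e 1 j) ⟩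
    (b₀ ⊗ (z ^F e) ⊕ evalDesc b (e ∸ 1) z) ⊕ w ⊗ (z ^F (e ∸ suc j)) ∎

  evalDesc-++ : ∀ {i j} (u : Vec Carrier i) (v : Vec Carrier j) e z →
                evalDesc (u Vec.++ v) e z ≡ evalDesc u e z ⊕ evalDesc v (e ∸ i) z
  evalDesc-++ []       v e z = sym (+-identityˡ _)
  evalDesc-++ {suc i} (u₀ ∷ u) v e z = begin
    u₀ ⊗ (z ^F e) ⊕ evalDesc (u Vec.++ v) (e ∸ 1) z
      ≡⟨ cong (u₀ ⊗ (z ^F e) ⊕_) (evalDesc-++ u v (e ∸ 1) z) ⟩
    u₀ ⊗ (z ^F e) ⊕ (evalDesc u (e ∸ 1) z ⊕ evalDesc v (e ∸ 1 ∸ i) z)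
      ≡⟨ +-assoc _ _ _ ⟨
    (u₀ ⊗ (z ^F e) ⊕ evalDesc u (e ∸ 1) z) ⊕ evalDesc v (e ∸ 1 ∸ i) z
      ≡⟨ cong (λ k → (u₀ ⊗ (z ^F e) ⊕ evalDesc u (e ∸ 1) z) ⊕ evalDesc v k z) (ℕ.∸-+-assoc e 1 i) ⟩
    (u₀ ⊗ (z ^F e) ⊕ evalDesc u (e ∸ 1) z) ⊕ evalDesc v (e ∸ suc i) z ∎

  eval-zero : ∀ k z → eval (Vec.replicate k 0#) z ≡ 0#
  eval-zero zero    z = refl
  eval-zero (suc k) z = ≡-trans (cong₂ _⊕_ (zeroˡ _) (eval-zero k z)) (+-identityˡ 0#)

  addLead : ∀ {k} → Carrier → Vec Carrier (suc k) → Vec Carrier (suc k)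
  addLead a (w ∷ ws) = (a ⊕ w) ∷ ws

  eval-addLead : ∀ {k} a (w : Vec Carrier (suc k)) z → eval (addLead a w) z ≡ a ⊗ (z ^F k) ⊕ eval w z
  eval-addLead {k} a (w ∷ ws) z = ≡-trans (cong (_⊕ eval ws z) (distribʳ (z ^F k) a w)) (+-assoc _ _ _)

  addLead-⊖-addLead : ∀ {k} a (w : Vec Carrier (suc k)) → addLead (⊖ a) (addLead a w) ≡ w
  addLead-⊖-addLead a (w ∷ ws) = cong (_∷ ws) (\\-leftDividesʳ a w)

  addLead-addLead-⊖ : ∀ {k} a (w : Vec Carrier (suc k)) → addLead a (addLead (⊖ a) w) ≡ w
  addLead-addLead-⊖ a (w ∷ ws) = cong (_∷ ws) (\\-leftDividesˡ a w)

  module SyntheticDivision (x : Carrier) where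

    -- fromRemQuot (y ∷ u) is the polynomial (T - x) u + y.
    fromRemQuot : ∀ k → Vec Carrier (suc k) → Vec Carrier (suc k)
    fromRemQuot zero    (y ∷ [])      = y ∷ []
    fromRemQuot (suc k) (y ∷ u₀ ∷ us) = u₀ ∷ addLead (⊖ (x ⊗ u₀)) (fromRemQuot k (y ∷ us))

    toRemQuot : ∀ k → Vec Carrier (suc k) → Vec Carrier (suc k)
    toRemQuot zero    (c ∷ [])  = c ∷ []
    toRemQuot (suc k) (c₀ ∷ cs) with toRemQuot k (addLead (x ⊗ c₀) cs)
    ... | y ∷ us = y ∷ c₀ ∷ us

    toRemQuot∘fromRemQuot : ∀ k v → toRemQuot k (fromRemQuot k v) ≡ v
    toRemQuot∘fromRemQuot zero    (y ∷ [])      = refl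
    toRemQuot∘fromRemQuot (suc k) (y ∷ u₀ ∷ us)
      rewrite addLead-addLead-⊖ (x ⊗ u₀) (fromRemQuot k (y ∷ us))
            | toRemQuot∘fromRemQuot k (y ∷ us) = refl

    fromRemQuot∘toRemQuot : ∀ k c → fromRemQuot k (toRemQuot k c) ≡ c
    fromRemQuot∘toRemQuot zero    (c ∷ [])  = refl
    fromRemQuot∘toRemQuot (suc k) (c₀ ∷ cs)
      with toRemQuot k (addLead (x ⊗ c₀) cs) | fromRemQuot∘toRemQuot k (addLead (x ⊗ c₀) cs)
    ... | y ∷ us | eq = cong (c₀ ∷_) (≡-trans (cong (addLead (⊖ (x ⊗ c₀))) eq) (addLead-⊖-addLead (x ⊗ c₀) cs))

    eval-fromRemQuot : ∀ k y (u : Vec Carrier k) z → eval (fromRemQuot k (y ∷ u)) z ≡ (z ⊕ ⊖ x) ⊗ eval u z ⊕ y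
    eval-fromRemQuot zero y [] z = begin
      y ⊗ 1# ⊕ 0#              ≡⟨ +-identityʳ _ ⟩
      y ⊗ 1#                   ≡⟨ *-identityʳ y ⟩
      y                        ≡⟨ +-identityˡ y ⟨
      0# ⊕ y                   ≡⟨ cong (_⊕ y) (zeroʳ (z ⊕ ⊖ x)) ⟨
      (z ⊕ ⊖ x) ⊗ 0# ⊕ y       ∎
    eval-fromRemQuot (suc k) y (u₀ ∷ us) z = begin
      u₀ ⊗ (z ⊗ zᵏ) ⊕ eval (addLead (⊖ (x ⊗ u₀)) (fromRemQuot k (y ∷ us))) z
        ≡⟨ cong (u₀ ⊗ (z ⊗ zᵏ) ⊕_) (eval-addLead (⊖ (x ⊗ u₀)) (fromRemQuot k (y ∷ us)) z) ⟩
      u₀ ⊗ (z ⊗ zᵏ) ⊕ (⊖ (x ⊗ u₀) ⊗ zᵏ ⊕ eval (fromRemQuot k (y ∷ us)) z)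
        ≡⟨ cong (λ t → u₀ ⊗ (z ⊗ zᵏ) ⊕ (⊖ (x ⊗ u₀) ⊗ zᵏ ⊕ t)) (eval-fromRemQuot k y us z) ⟩
      u₀ ⊗ (z ⊗ zᵏ) ⊕ (⊖ (x ⊗ u₀) ⊗ zᵏ ⊕ ((z ⊕ ⊖ x) ⊗ p ⊕ y))
        ≡⟨ cong₂ (λ s t → s ⊕ (t ⊕ ((z ⊕ ⊖ x) ⊗ p ⊕ y))) u₀zzᵏ≡zu₀zᵏ -xu₀zᵏ≡-xu₀zᵏ ⟩
      z ⊗ (u₀ ⊗ zᵏ) ⊕ (⊖ x ⊗ (u₀ ⊗ zᵏ) ⊕ ((z ⊕ ⊖ x) ⊗ p ⊕ y))
        ≡⟨ +-assoc _ _ _ ⟨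
      (z ⊗ (u₀ ⊗ zᵏ) ⊕ ⊖ x ⊗ (u₀ ⊗ zᵏ)) ⊕ ((z ⊕ ⊖ x) ⊗ p ⊕ y)
        ≡⟨ cong (_⊕ ((z ⊕ ⊖ x) ⊗ p ⊕ y)) (distribʳ (u₀ ⊗ zᵏ) z (⊖ x)) ⟨
      (z ⊕ ⊖ x) ⊗ (u₀ ⊗ zᵏ) ⊕ ((z ⊕ ⊖ x) ⊗ p ⊕ y)
        ≡⟨ +-assoc _ _ _ ⟨
      ((z ⊕ ⊖ x) ⊗ (u₀ ⊗ zᵏ) ⊕ (z ⊕ ⊖ x) ⊗ p) ⊕ y
        ≡⟨ cong (_⊕ y) (distribˡ (z ⊕ ⊖ x) (u₀ ⊗ zᵏ) p) ⟨
      (z ⊕ ⊖ x) ⊗ (u₀ ⊗ zᵏ ⊕ p) ⊕ y ∎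
      where
      zᵏ = z ^F k
      p  = eval us z
      u₀zzᵏ≡zu₀zᵏ : u₀ ⊗ (z ⊗ zᵏ) ≡ z ⊗ (u₀ ⊗ zᵏ)
      u₀zzᵏ≡zu₀zᵏ = ≡-trans (sym (*-assoc u₀ z zᵏ)) (≡-trans (cong (_⊗ zᵏ) (*-comm u₀ z)) (*-assoc z u₀ zᵏ))
      -xu₀zᵏ≡-xu₀zᵏ : ⊖ (x ⊗ u₀) ⊗ zᵏ ≡ ⊖ x ⊗ (u₀ ⊗ zᵏ)
      -xu₀zᵏ≡-xu₀zᵏ = ≡-trans (sym (-‿distribˡ-* (x ⊗ u₀) zᵏ))
                        (≡-trans (cong ⊖_ (*-assoc x u₀ zᵏ)) (-‿distribˡ-* x (u₀ ⊗ zᵏ)))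

    eval-fromRemQuot-at-root : ∀ k y (u : Vec Carrier k) → eval (fromRemQuot k (y ∷ u)) x ≡ y
    eval-fromRemQuot-at-root k y u = begin
      eval (fromRemQuot k (y ∷ u)) x     ≡⟨ eval-fromRemQuot k y u x ⟩
      (x ⊕ ⊖ x) ⊗ eval u x ⊕ y           ≡⟨ cong (λ s → s ⊗ eval u x ⊕ y) (-‿inverseʳ x) ⟩
      0# ⊗ eval u x ⊕ y                  ≡⟨ cong (_⊕ y) (zeroˡ (eval u x)) ⟩
      0# ⊕ y                             ≡⟨ +-identityˡ y ⟩
      y                                  ∎

  -- Sums over coefficient vectors and interpolation

  allVecs-unique : ∀ k → Unique (allVecs k)
  allVecs-unique zero    = All.[] ∷ []
  allVecs-unique (suc k) = subst Unique (sym (concatMap≡cartesianProduct elements))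
    (Unique.cartesianProductWith⁺ _∷_ Vec.∷-injective unique (allVecs-unique k))
    where
    concatMap≡cartesianProduct : ∀ xs → concatMap (λ x → map (x ∷_) (allVecs k)) xs
                                        ≡ cartesianProductWith _∷_ xs (allVecs k)
    concatMap≡cartesianProduct []       = refl
    concatMap≡cartesianProduct (x ∷ xs) = cong (map (x ∷_) (allVecs k) ++_) (concatMap≡cartesianProduct xs)

  ∑-allVecs-∷ : ∀ k (g : Vec Carrier (suc k) → ℚ) →
                ∑ (allVecs (suc k)) g ≡ ∑[ y ← elements ] ∑[ u ← allVecs k ] g (y ∷ u)
  ∑-allVecs-∷ k g = ≡-trans (∑-concatMap (λ x → map (x ∷_) (allVecs k)) elements g)
                            (∑-cong elements (λ y → ∑-map (y ∷_) (allVecs k) g))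

  ∑-allVecs-∷ʳ : ∀ k (g : Vec Carrier (suc k) → ℚ) →
                 ∑ (allVecs (suc k)) g ≡ ∑[ u ← allVecs k ] ∑[ y ← elements ] g (u ∷ʳ y)
  ∑-allVecs-∷ʳ zero    g = ≡-trans (∑-allVecs-∷ zero g)
                             (≡-trans (∑-cong elements (λ y → ℚ.+-identityʳ _)) (sym (ℚ.+-identityʳ _)))
  ∑-allVecs-∷ʳ (suc k) g = begin
    ∑ (allVecs (suc (suc k))) g
      ≡⟨ ∑-allVecs-∷ (suc k) g ⟩
    ∑[ y ← elements ] ∑[ u ← allVecs (suc k) ] g (y ∷ u)
      ≡⟨ ∑-cong elements (λ y → ∑-allVecs-∷ʳ k (λ u → g (y ∷ u))) ⟩
    ∑[ y ← elements ] ∑[ u ← allVecs k ] ∑[ y′ ← elements ] g (y ∷ (u ∷ʳ y′))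
      ≡⟨ ∑-allVecs-∷ k (λ u → ∑[ y′ ← elements ] g (u ∷ʳ y′)) ⟨
    ∑[ u ← allVecs (suc k) ] ∑[ y′ ← elements ] g (u ∷ʳ y′) ∎

  ∑-allVecs-1 : ∀ k → ∑[ _ ← allVecs k ] 1ℚ ≡ ℕtoℚ (q ℕ.^ k)
  ∑-allVecs-1 zero    = ℚ.+-identityʳ 1ℚ
  ∑-allVecs-1 (suc k) = begin
    ∑[ _ ← allVecs (suc k) ] 1ℚ                        ≡⟨ ∑-allVecs-∷ k (λ _ → 1ℚ) ⟩
    ∑[ _ ← elements ] ∑[ _ ← allVecs k ] 1ℚ           ≡⟨ ∑-cong elements (λ _ → ∑-allVecs-1 k) ⟩
    ∑[ _ ← elements ] ℕtoℚ (q ℕ.^ k)                  ≡⟨ ∑-const elements (ℕtoℚ (q ℕ.^ k)) ⟩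
    ℕtoℚ q * ℕtoℚ (q ℕ.^ k)                            ≡⟨ ℕtoℚ-* q (q ℕ.^ k) ⟨
    ℕtoℚ (q ℕ.^ suc k)                                 ∎

  -- b carries the exponents m, …, 1; with c = b ∷ʳ (- v) the level set {h + b = v} is the zero set of h + c.
  ∑-level≡∑-zero : ∀ m (h : Carrier → Carrier) (X : List Carrier) →
    ∑[ b ← allVecs m ] ∑[ v ← elements ] when (all? (λ x → (h x ⊕ evalDesc b m x) ≟F v) X) 1ℚ
    ≡ ∑[ c ← allVecs (suc m) ] when (all? (λ x → (h x ⊕ evalDesc c m x) ≟F 0#) X) 1ℚ
  ∑-level≡∑-zero m h X = sym (begin
    ∑[ c ← allVecs (suc m) ] zeroOn c
      ≡⟨ ∑-allVecs-∷ʳ m zeroOn ⟩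
    ∑[ b ← allVecs m ] ∑[ w ← elements ] zeroOn (b ∷ʳ w)
      ≡⟨ ∑-cong (allVecs m) (λ b → ∑-cong elements (λ w → zeroOn-∷ʳ b w)) ⟩
    ∑[ b ← allVecs m ] ∑[ w ← elements ] levelOn b (⊖ w)
      ≡⟨ ∑-cong (allVecs m) (λ b →
           ∑-bijection elements unique complete ⊖_ ⊖_ ⁻¹-involutive ⁻¹-involutive (levelOn b)) ⟩
    ∑[ b ← allVecs m ] ∑[ v ← elements ] levelOn b v ∎)
    where
    zeroOn : Vec Carrier (suc m) → ℚ
    zeroOn c = when (all? (λ x → (h x ⊕ evalDesc c m x) ≟F 0#) X) 1ℚ
    levelOn : Vec Carrier m → Carrier → ℚ
    levelOn b v = when (all? (λ x → (h x ⊕ evalDesc b m x) ≟F v) X) 1ℚ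
    eval-∷ʳ : ∀ (b : Vec Carrier m) w x → h x ⊕ evalDesc (b ∷ʳ w) m x ≡ (h x ⊕ evalDesc b m x) ⊕ w
    eval-∷ʳ b w x = begin
      h x ⊕ evalDesc (b ∷ʳ w) m x                 ≡⟨ cong (h x ⊕_) (evalDesc-∷ʳ b m w x) ⟩
      h x ⊕ (evalDesc b m x ⊕ w ⊗ (x ^F (m ∸ m)))
        ≡⟨ cong (λ k → h x ⊕ (evalDesc b m x ⊕ w ⊗ (x ^F k))) (ℕ.n∸n≡0 m) ⟩
      h x ⊕ (evalDesc b m x ⊕ w ⊗ 1#)             ≡⟨ cong (λ k → h x ⊕ (evalDesc b m x ⊕ k)) (*-identityʳ w) ⟩
      h x ⊕ (evalDesc b m x ⊕ w)                  ≡⟨ +-assoc _ _ _ ⟨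
      (h x ⊕ evalDesc b m x) ⊕ w                  ∎
    zeroOn-∷ʳ : ∀ b w → zeroOn (b ∷ʳ w) ≡ levelOn b (⊖ w)
    zeroOn-∷ʳ b w = when-cong (all? (λ x → (h x ⊕ evalDesc (b ∷ʳ w) m x) ≟F 0#) X)
                              (all? (λ x → (h x ⊕ evalDesc b m x) ≟F (⊖ w)) X) 1ℚ
      (All.map (λ {x} e → ≡-trans (x≈z//y _ w 0# (≡-trans (sym (eval-∷ʳ b w x)) e)) (+-identityˡ (⊖ w))))
      (All.map (λ {x} e → ≡-trans (eval-∷ʳ b w x) (x≡z-y⇒x+y≡z _ w 0# (≡-trans e (sym (+-identityˡ (⊖ w)))))))

  Interpolates : ∀ {k} → Vec Carrier k → (Carrier → Carrier) → List Carrier → Set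
  Interpolates c t X = All (λ z → eval c z ≡ t z) X

  interpolates? : ∀ {k} (c : Vec Carrier k) t X → Dec (Interpolates c t X)
  interpolates? c t X = all? (λ z → eval c z ≟F t z) X

  dividedDifference : Carrier → (Carrier → Carrier) → Carrier → Carrier
  dividedDifference x t z = (t z ⊕ ⊖ t x) ⊗ (z ⊕ ⊖ x) ⁻¹

  module _ {x : Carrier} {t : Carrier → Carrier} {X : List Carrier} (x∉X : x ∉ X) where
    open SyntheticDivision x

    private
      z-x≢0 : ∀ {z} → z ∈ X → ¬ z ⊕ ⊖ x ≡ 0#
      z-x≢0 {z} z∈X = x≢y⇒x-y≢0 z x (λ { refl → x∉X z∈X })

    interpolates-fromRemQuot⁻ : ∀ k y (u : Vec Carrier k) → Interpolates (fromRemQuot k (y ∷ u)) t (x ∷ X) →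
                                y ≡ t x × Interpolates u (dividedDifference x t) X
    interpolates-fromRemQuot⁻ k y u (at-x ∷ on-X) = y≡tx , All-map-∈ (λ {z} z∈X at-z →
        a*p+b≡c⇒p≡[c-b]/a (z ⊕ ⊖ x) (eval u z) (t x) (t z) (z-x≢0 z∈X)
          (subst (λ w → (z ⊕ ⊖ x) ⊗ eval u z ⊕ w ≡ t z) y≡tx (≡-trans (sym (eval-fromRemQuot k y u z)) at-z)))
      on-X
      where
      y≡tx = ≡-trans (sym (eval-fromRemQuot-at-root k y u)) at-x

    interpolates-fromRemQuot⁺ : ∀ k y (u : Vec Carrier k) → y ≡ t x → Interpolates u (dividedDifference x t) X →
                                Interpolates (fromRemQuot k (y ∷ u)) t (x ∷ X)
    interpolates-fromRemQuot⁺ k y u refl on-X = eval-fromRemQuot-at-root k y u ∷ All-map-∈ (λ {z} z∈X at-z →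
        ≡-trans (eval-fromRemQuot k y u z) (p≡[c-b]/a⇒a*p+b≡c (z ⊕ ⊖ x) (eval u z) (t x) (t z) (z-x≢0 z∈X) at-z))
      on-X

  interpolant-count : ∀ k (X : List Carrier) (t : Carrier → Carrier) → Unique X → length X ≤ k →
                      ∑[ c ← allVecs k ] when (interpolates? c t X) 1ℚ ≡ ℕtoℚ (q ℕ.^ (k ∸ length X))
  interpolant-count k       []      t _ _ = ∑-allVecs-1 k
  interpolant-count (suc k) (x ∷ X) t !x∷X@(_ ∷ !X) (ℕ.s≤s |X|≤k) = begin
    ∑[ c ← allVecs (suc k) ] when (interpolates? c t (x ∷ X)) 1ℚ
      ≡⟨ ∑-bijection (allVecs (suc k)) (allVecs-unique (suc k)) allVecs-complete (fromRemQuot k) (toRemQuot k)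
           (toRemQuot∘fromRemQuot k) (fromRemQuot∘toRemQuot k) (λ c → when (interpolates? c t (x ∷ X)) 1ℚ) ⟨
    ∑[ c ← allVecs (suc k) ] when (interpolates? (fromRemQuot k c) t (x ∷ X)) 1ℚ
      ≡⟨ ∑-allVecs-∷ k _ ⟩
    ∑[ y ← elements ] ∑[ u ← allVecs k ] when (interpolates? (fromRemQuot k (y ∷ u)) t (x ∷ X)) 1ℚ
      ≡⟨ ∑-cong elements (λ y → ∑-cong (allVecs k) (λ u → split y u)) ⟩
    ∑[ y ← elements ] ∑[ u ← allVecs k ] when (y ≟F t x) (when (interpolates? u t′ X) 1ℚ)
      ≡⟨ ∑-cong elements (λ y → ∑-when (y ≟F t x) (allVecs k) _) ⟩
    ∑[ y ← elements ] when (y ≟F t x) (∑[ u ← allVecs k ] when (interpolates? u t′ X) 1ℚ)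
      ≡⟨ ∑-delta _≟F_ elements (t x) _ unique (complete (t x)) ⟩
    ∑[ u ← allVecs k ] when (interpolates? u t′ X) 1ℚ
      ≡⟨ interpolant-count k X t′ !X |X|≤k ⟩
    ℕtoℚ (q ℕ.^ (k ∸ length X)) ∎
    where
    open SyntheticDivision x
    t′ = dividedDifference x t
    x∉X = Unique.Unique[x∷xs]⇒x∉xs !x∷X
    split : ∀ y u → when (interpolates? (fromRemQuot k (y ∷ u)) t (x ∷ X)) 1ℚ
                    ≡ when (y ≟F t x) (when (interpolates? u t′ X) 1ℚ)
    split y u = ≡-trans
      (when-cong (interpolates? (fromRemQuot k (y ∷ u)) t (x ∷ X)) ((y ≟F t x) ×-dec interpolates? u t′ X) 1ℚ
        (interpolates-fromRemQuot⁻ x∉X k y u) (λ (y≡tx , on-X) → interpolates-fromRemQuot⁺ x∉X k y u y≡tx on-X))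
      (when-×-dec (y ≟F t x) (interpolates? u t′ X) 1ℚ)

  interpolant-unique : ∀ k (X : List Carrier) (t : Carrier → Carrier) → Unique X → k ≤ length X →
                       (c₁ c₂ : Vec Carrier k) → Interpolates c₁ t X → Interpolates c₂ t X → c₁ ≡ c₂
  interpolant-unique zero    X       t _ _ [] [] _ _ = refl
  interpolant-unique (suc k) (x ∷ X) t !x∷X@(_ ∷ !X) (ℕ.s≤s k≤|X|) c₁ c₂ on-X₁ on-X₂ = begin
    c₁                              ≡⟨ fromRemQuot∘toRemQuot k c₁ ⟨
    fromRemQuot k (toRemQuot k c₁)  ≡⟨ cong (fromRemQuot k) (same-toRemQuot (toRemQuot k c₁) (toRemQuot k c₂)
                                         (interpolates-toRemQuot c₁ on-X₁) (interpolates-toRemQuot c₂ on-X₂)) ⟩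
    fromRemQuot k (toRemQuot k c₂)  ≡⟨ fromRemQuot∘toRemQuot k c₂ ⟩
    c₂                              ∎
    where
    open SyntheticDivision x
    x∉X = Unique.Unique[x∷xs]⇒x∉xs !x∷X
    interpolates-toRemQuot : ∀ c → Interpolates c t (x ∷ X) → Interpolates (fromRemQuot k (toRemQuot k c)) t (x ∷ X)
    interpolates-toRemQuot c = subst (λ c′ → Interpolates c′ t (x ∷ X)) (sym (fromRemQuot∘toRemQuot k c))
    same-toRemQuot : ∀ v₁ v₂ → Interpolates (fromRemQuot k v₁) t (x ∷ X) → Interpolates (fromRemQuot k v₂) t (x ∷ X) →
                     v₁ ≡ v₂
    same-toRemQuot (y₁ ∷ u₁) (y₂ ∷ u₂) p₁ p₂
      with interpolates-fromRemQuot⁻ x∉X k y₁ u₁ p₁ | interpolates-fromRemQuot⁻ x∉X k y₂ u₂ p₂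
    ... | y₁≡tx , q₁ | y₂≡tx , q₂ =
      cong₂ _∷_ (≡-trans y₁≡tx (sym y₂≡tx)) (interpolant-unique k X (dividedDifference x t) !X k≤|X| u₁ u₂ q₁ q₂)

  -- Subsets of F_q and inclusion–exclusion

  ∈-sublists-∷⁻ : ∀ {x} xs {X} → X ∈ sublists (x ∷ xs) →
                  (∃ λ X′ → X ≡ x ∷ X′ × X′ ∈ sublists xs) ⊎ X ∈ sublists xs
  ∈-sublists-∷⁻ {x} xs X∈ with ∈.∈-++⁻ (map (x ∷_) (sublists xs)) X∈
  ... | inj₂ X∈xs = inj₂ X∈xs
  ... | inj₁ X∈x∷ with ∈.∈-map⁻ (x ∷_) X∈x∷
  ...   | X′ , X′∈ , refl = inj₁ (X′ , refl , X′∈)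

  sublists-length≤ : ∀ xs {X} → X ∈ sublists xs → length X ≤ length xs
  sublists-length≤ []       (here refl) = ℕ.z≤n
  sublists-length≤ (x ∷ xs) X∈ with ∈-sublists-∷⁻ xs X∈
  ... | inj₁ (X′ , refl , X′∈) = ℕ.s≤s (sublists-length≤ xs X′∈)
  ... | inj₂ X∈xs              = ℕ.m≤n⇒m≤1+n (sublists-length≤ xs X∈xs)

  sublists-⊆ : ∀ xs {X} → X ∈ sublists xs → ∀ {z} → z ∈ X → z ∈ xs
  sublists-⊆ [] (here refl) ()
  sublists-⊆ (x ∷ xs) X∈ z∈ with ∈-sublists-∷⁻ xs X∈ | z∈
  ... | inj₁ (X′ , refl , X′∈) | here refl = here refl
  ... | inj₁ (X′ , refl , X′∈) | there z∈X′ = there (sublists-⊆ xs X′∈ z∈X′)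
  ... | inj₂ X∈xs              | _          = there (sublists-⊆ xs X∈xs z∈)

  sublists-unique : ∀ xs {X} → Unique xs → X ∈ sublists xs → Unique X
  sublists-unique []       _            (here refl) = []
  sublists-unique (x ∷ xs) (x≢xs ∷ !xs) X∈ with ∈-sublists-∷⁻ xs X∈
  ... | inj₁ (X′ , refl , X′∈) =
    All.tabulate (λ z∈ → All.lookup x≢xs (sublists-⊆ xs X′∈ z∈)) ∷ sublists-unique xs !xs X′∈
  ... | inj₂ X∈xs              = sublists-unique xs !xs X∈xs

  ∑-sublists-∷ : ∀ x xs (f : List Carrier → ℚ) →
                 ∑ (sublists (x ∷ xs)) f ≡ ∑[ X ← sublists xs ] f (x ∷ X) + ∑ (sublists xs) f
  ∑-sublists-∷ x xs f = ≡-trans (∑-++ (map (x ∷_) (sublists xs)) (sublists xs) f)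
                                (cong (_+ ∑ (sublists xs) f) (∑-map (x ∷_) (sublists xs) f))

  ∑-sublists-ofLength : ∀ xs r → ∑[ X ← sublists xs ] when (length X ℕ.≟ r) 1ℚ ≡ ℕtoℚ (length xs C r)
  ∑-sublists-ofLength []       zero    = ℚ.+-identityʳ 1ℚ
  ∑-sublists-ofLength []       (suc r) = ℚ.+-identityʳ 0ℚ
  ∑-sublists-ofLength (x ∷ xs) zero    = begin
    ∑[ X ← sublists (x ∷ xs) ] when (length X ℕ.≟ 0) 1ℚ
      ≡⟨ ∑-sublists-∷ x xs _ ⟩
    ∑[ X ← sublists xs ] when (suc (length X) ℕ.≟ 0) 1ℚ + ∑[ X ← sublists xs ] when (length X ℕ.≟ 0) 1ℚ
      ≡⟨ cong₂ _+_ (∑-vanishes (sublists xs) _ (λ X _ → when-no (suc (length X) ℕ.≟ 0) 1ℚ (λ ())))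
                   (∑-sublists-ofLength xs zero) ⟩
    0ℚ + ℕtoℚ 1
      ≡⟨ ℚ.+-identityˡ _ ⟩
    ℕtoℚ 1 ∎
  ∑-sublists-ofLength (x ∷ xs) (suc r) = begin
    ∑[ X ← sublists (x ∷ xs) ] when (length X ℕ.≟ suc r) 1ℚ
      ≡⟨ ∑-sublists-∷ x xs _ ⟩
    ∑[ X ← sublists xs ] when (suc (length X) ℕ.≟ suc r) 1ℚ + ∑[ X ← sublists xs ] when (length X ℕ.≟ suc r) 1ℚ
      ≡⟨ cong₂ _+_ (≡-trans (∑-cong (sublists xs) (λ X → when-cong (suc (length X) ℕ.≟ suc r) (length X ℕ.≟ r) 1ℚ
                                ℕ.suc-injective (cong suc)))
                            (∑-sublists-ofLength xs r))
                   (∑-sublists-ofLength xs (suc r)) ⟩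
    ℕtoℚ (length xs C r) + ℕtoℚ (length xs C suc r)
      ≡⟨ ℕtoℚ-+ (length xs C r) (length xs C suc r) ⟨
    ℕtoℚ (length xs C r ℕ.+ length xs C suc r)
      ≡⟨ cong ℕtoℚ (nCk+nC[k+1]≡[n+1]C[k+1] (length xs) r) ⟩
    ℕtoℚ (suc (length xs) C suc r) ∎

  #subsetsOfSize : ∀ r → ℕtoℚ (length (subsetsOfSize r)) ≡ ℕtoℚ (q C r)
  #subsetsOfSize r = begin
    ℕtoℚ (length (subsetsOfSize r))                            ≡⟨ length≡∑1 (subsetsOfSize r) ⟩
    ∑[ _ ← subsetsOfSize r ] 1ℚ                                ≡⟨ ∑-filter (λ X → length X ℕ.≟ r) (sublists elements) _ ⟩
    ∑[ X ← sublists elements ] when (length X ℕ.≟ r) 1ℚ        ≡⟨ ∑-sublists-ofLength elements r ⟩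
    ℕtoℚ (q C r)                                               ∎

  ∈-subsetsOfSize⁻ : ∀ {r X} → X ∈ subsetsOfSize r → Unique X × length X ≡ r
  ∈-subsetsOfSize⁻ {r} X∈ with ∈.∈-filter⁻ (λ X → length X ℕ.≟ r) {xs = sublists elements} X∈
  ... | X∈sublists , |X|≡r = sublists-unique elements unique X∈sublists , |X|≡r

  inclusion-exclusion : {P : Carrier → Set} (P? : ∀ x → Dec (P x)) (xs : List Carrier) →
    ∑[ X ← sublists xs ] signQ (length X) * when (all? P? X) 1ℚ ≡ 1ℚ + - when (any? P? xs) 1ℚ
  inclusion-exclusion P? [] = begin
    1ℚ * 1ℚ + 0ℚ   ≡⟨ ℚ.+-identityʳ _ ⟩
    1ℚ * 1ℚ        ≡⟨ ℚ.*-identityʳ 1ℚ ⟩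
    1ℚ             ≡⟨ ℚ.+-identityʳ 1ℚ ⟨
    1ℚ + - 0ℚ      ∎
  inclusion-exclusion {P} P? (x ∷ xs) = begin
    ∑[ X ← sublists (x ∷ xs) ] signQ (length X) * when (all? P? X) 1ℚ
      ≡⟨ ∑-sublists-∷ x xs _ ⟩
    ∑[ X ← sublists xs ] signQ (suc (length X)) * when (all? P? (x ∷ X)) 1ℚ + S
      ≡⟨ cong (_+ S) (∑-cong (sublists xs) (λ X → cong (- signQ (length X) *_) (when-×-dec (P? x) (all? P? X) 1ℚ))) ⟩
    ∑[ X ← sublists xs ] - signQ (length X) * when (P? x) (when (all? P? X) 1ℚ) + S
      ≡⟨ by-cases (P? x) ⟩
    1ℚ + - when (any? P? (x ∷ xs)) 1ℚ ∎
    where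
    S = ∑[ X ← sublists xs ] signQ (length X) * when (all? P? X) 1ℚ
    by-cases : (d : Dec (P x)) → ∑[ X ← sublists xs ] - signQ (length X) * when d (when (all? P? X) 1ℚ) + S
                                 ≡ 1ℚ + - when (any? P? (x ∷ xs)) 1ℚ
    by-cases (yes Px) = begin
      ∑[ X ← sublists xs ] - signQ (length X) * when (all? P? X) 1ℚ + S
        ≡⟨ cong (_+ S) (≡-trans (∑-cong (sublists xs) (λ X → sym (ℚ.neg-distribˡ-* (signQ (length X)) _)))
                                (∑-neg (sublists xs) _)) ⟩
      - S + S                                   ≡⟨ ℚ.+-inverseˡ S ⟩
      0ℚ                                        ≡⟨ ℚ.+-inverseʳ 1ℚ ⟨
      1ℚ + - 1ℚ                                 ≡⟨ cong (λ w → 1ℚ + - w) (when-yes (any? P? (x ∷ xs)) 1ℚ (here Px)) ⟨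
      1ℚ + - when (any? P? (x ∷ xs)) 1ℚ        ∎
    by-cases (no ¬Px) = begin
      ∑[ X ← sublists xs ] - signQ (length X) * 0ℚ + S
        ≡⟨ cong (_+ S) (∑-vanishes (sublists xs) _ (λ X _ → ℚ.*-zeroʳ (- signQ (length X)))) ⟩
      0ℚ + S                                    ≡⟨ ℚ.+-identityˡ S ⟩
      S                                         ≡⟨ inclusion-exclusion P? xs ⟩
      1ℚ + - when (any? P? xs) 1ℚ
        ≡⟨ cong (λ w → 1ℚ + - w) (when-cong (any? P? xs) (any? P? (x ∷ xs)) 1ℚ there
             (λ { (here Px) → ⊥-elim (¬Px Px) ; (there Pxs) → Pxs })) ⟩
      1ℚ + - when (any? P? (x ∷ xs)) 1ℚ        ∎

  valueSetSize≡∑ : ∀ (h : Carrier → Carrier) →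
                   ℕtoℚ (valueSetSize h) ≡ ∑[ v ← elements ] when (any? (λ x → h x ≟F v) elements) 1ℚ
  valueSetSize≡∑ h = begin
    ℕtoℚ (length values)                  ≡⟨ length≡∑1 values ⟩
    ∑[ _ ← values ] 1ℚ                    ≡⟨ ∑-unique-set values (filter attained? elements) _
                                               (deduplicate-! (map h elements)) (Unique.filter⁺ attained? unique)
                                               values⊆attained attained⊆values ⟩
    ∑[ _ ← filter attained? elements ] 1ℚ ≡⟨ ∑-filter attained? elements _ ⟩
    ∑[ v ← elements ] when (attained? v) 1ℚ ∎
    where
    values = deduplicate _≟F_ (map h elements)
    attained? = λ v → any? (λ x → h x ≟F v) elements
    values⊆attained : ∀ {v} → v ∈ values → v ∈ filter attained? elements
    values⊆attained v∈ with ∈.∈-map⁻ h (∈.∈-deduplicate⁻ _≟F_ (map h elements) v∈)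
    ... | x , x∈ , refl = ∈.∈-filter⁺ attained? (complete (h x)) (lose x∈ refl)
    attained⊆values : ∀ {v} → v ∈ filter attained? elements → v ∈ values
    attained⊆values v∈ with find (proj₂ (∈.∈-filter⁻ attained? {xs = elements} v∈))
    ... | x , x∈ , refl = ∈.∈-deduplicate⁺ _≟F_ (∈.∈-map⁺ h x∈)

  -- The average value set size

  invPowQ-+-* : ∀ i j → invPowQ (i ℕ.+ j) * ℕtoℚ (q ℕ.^ j) ≡ invPowQ i
  invPowQ-+-* i j = ≡-trans (cong (_* ℕtoℚ (q ℕ.^ j)) 1/q^[i+j]≡1/[q^i*q^j]) (1/[m*n]*n≡1/m (q ℕ.^ i) (q ℕ.^ j))
    where
    instance
      _ = FiniteField.q-nonZero F
      q^i≢0   = ℕ.m^n≢0 q i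
      q^j≢0   = ℕ.m^n≢0 q j
      q^i*q^j≢0 = ℕ.m*n≢0 (q ℕ.^ i) (q ℕ.^ j)
      q^[i+j]≢0 = ℕ.m^n≢0 q (i ℕ.+ j)
    1/q^[i+j]≡1/[q^i*q^j] : invPowQ (i ℕ.+ j) ≡ (ℤ.+ 1) ℚ./ (q ℕ.^ i ℕ.* q ℕ.^ j)
    1/q^[i+j]≡1/[q^i*q^j] = ℚ./-cong {ℤ.+ 1} {q ℕ.^ (i ℕ.+ j)} refl (ℕ.^-distribˡ-+-* q i j)

  module ValueSetAverage (d s : ℕ) (d<q : d < q) (1≤s : 1 ≤ s) (s≤d∸2 : s ≤ d ∸ 2) (a : Vec Carrier s) where

    n m : ℕ
    n = d ∸ s
    m = n ∸ 1

    1≤n : 1 ≤ n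
    1≤n = 1≤d∸s d s 1≤s s≤d∸2
      where
      1≤d∸s : ∀ d s → 1 ≤ s → s ≤ d ∸ 2 → 1 ≤ d ∸ s
      1≤d∸s zero          (suc _) _ ()
      1≤d∸s (suc zero)    (suc _) _ ()
      1≤d∸s (suc (suc d)) s       _ s≤d rewrite ℕ.+-∸-assoc 2 s≤d = ℕ.s≤s ℕ.z≤n

    n≡1+m : n ≡ suc m
    n≡1+m = sym (ℕ.m+[n∸m]≡n 1≤n)

    n≤d : n ≤ d
    n≤d = ℕ.m∸n≤m d s

    s+n≡d : s ℕ.+ n ≡ d
    s+n≡d = ℕ.m+[n∸m]≡n (ℕ.≤-trans s≤d∸2 (ℕ.m∸n≤m d 2))

    f : Carrier → Carrier
    f = fa d s a

    zeroSet? : ∀ {k} (c : Vec Carrier k) X → Dec (All (λ x → f x ⊕ evalDesc c m x ≡ 0#) X)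
    zeroSet? c X = all? (λ x → (f x ⊕ evalDesc c m x) ≟F 0#) X

    -- N n X counts the g of degree < n with f + g = 0 on X; k is general only to transport along n ≡ suc m.
    N : ℕ → List Carrier → ℚ
    N k X = ∑[ c ← allVecs k ] when (zeroSet? c X) 1ℚ

    zeroSet⇒interpolates : ∀ (c : Vec Carrier n) {X} → All (λ x → f x ⊕ eval c x ≡ 0#) X → Interpolates c (⊖_ ∘ f) X
    zeroSet⇒interpolates c = All.map (λ {x} → inverseʳ-unique (f x) (eval c x))

    interpolates⇒zeroSet : ∀ (c : Vec Carrier n) {X} → Interpolates c (⊖_ ∘ f) X → All (λ x → f x ⊕ eval c x ≡ 0#) X
    interpolates⇒zeroSet c = All.map (λ {x} eval≡-f → ≡-trans (cong (f x ⊕_) eval≡-f) (-‿inverseʳ (f x)))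

    N-few : ∀ X → Unique X → length X ≤ n → N n X ≡ ℕtoℚ (q ℕ.^ (n ∸ length X))
    N-few X !X |X|≤n = ≡-trans
      (∑-cong (allVecs n) (λ c → when-cong (zeroSet? c X) (interpolates? c (⊖_ ∘ f) X) 1ℚ
        (zeroSet⇒interpolates c) (interpolates⇒zeroSet c)))
      (interpolant-count n X (⊖_ ∘ f) !X |X|≤n)

    N-many : ∀ X → Unique X → n ≤ length X → N n X ≡ when (vanishes? d s a X) 1ℚ
    N-many X !X n≤|X| = by-cases (vanishes? d s a X)
      where
      by-cases : (v? : Dec (Vanishes d s a X)) → N n X ≡ when v? 1ℚ
      by-cases (yes (c₀ , c₀-vanishes)) = ≡-trans
        (∑-cong (allVecs n) (λ c → when-cong (zeroSet? c X) (Vec.≡-dec _≟F_ c c₀) 1ℚ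
          (λ c-vanishes → interpolant-unique n X (⊖_ ∘ f) !X n≤|X| c c₀
            (zeroSet⇒interpolates c c-vanishes) (zeroSet⇒interpolates c₀ c₀-vanishes))
          (λ { refl → c₀-vanishes })))
        (∑-delta (Vec.≡-dec _≟F_) (allVecs n) c₀ 1ℚ (allVecs-unique n) (allVecs-complete c₀))
      by-cases (no ¬vanishes) =
        ∑-vanishes (allVecs n) _ (λ c _ → when-no (zeroSet? c X) 1ℚ (λ c-vanishes → ¬vanishes (c , c-vanishes)))

    -- f + g is monic of degree d: vanishing on d + 1 points would make it the zero polynomial by uniqueness of
    -- interpolation.
    N-tooMany : ∀ X → Unique X → d < length X → N n X ≡ 0ℚ
    N-tooMany X !X d<|X| = ∑-vanishes (allVecs n) _ (λ c _ → when-no (zeroSet? c X) 1ℚ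
      (λ c-vanishes → 0≢1 (sym (proj₁ (Vec.∷-injective (monic≡0 c c-vanishes))))))
      where
      monic : Vec Carrier n → Vec Carrier (suc (s ℕ.+ n))
      monic c = 1# ∷ (a Vec.++ c)
      d∸1∸s≡m : d ∸ 1 ∸ s ≡ m
      d∸1∸s≡m = ≡-trans (ℕ.∸-+-assoc d 1 s) (≡-trans (cong (d ∸_) (ℕ.+-comm 1 s)) (sym (ℕ.∸-+-assoc d s 1)))
      -- Stated for any e ≡ d: the index of monic c is suc (s + n), which is only propositionally suc d.
      eval-monic : ∀ e → e ≡ d → (c : Vec Carrier n) (z : Carrier) →
                   1# ⊗ (z ^F e) ⊕ evalDesc (a Vec.++ c) (e ∸ 1) z ≡ f z ⊕ evalDesc c m z
      eval-monic .d refl c z = begin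
        1# ⊗ (z ^F d) ⊕ evalDesc (a Vec.++ c) (d ∸ 1) z
          ≡⟨ cong₂ _⊕_ (*-identityˡ _) (evalDesc-++ a c (d ∸ 1) z) ⟩
        z ^F d ⊕ (evalDesc a (d ∸ 1) z ⊕ evalDesc c (d ∸ 1 ∸ s) z)
          ≡⟨ cong (λ k → z ^F d ⊕ (evalDesc a (d ∸ 1) z ⊕ evalDesc c k z)) d∸1∸s≡m ⟩
        z ^F d ⊕ (evalDesc a (d ∸ 1) z ⊕ evalDesc c m z)
          ≡⟨ +-assoc _ _ _ ⟨
        f z ⊕ evalDesc c m z ∎
      monic≡0 : ∀ c → All (λ x → f x ⊕ evalDesc c m x ≡ 0#) X → monic c ≡ Vec.replicate (suc (s ℕ.+ n)) 0#
      monic≡0 c c-vanishes = interpolant-unique (suc (s ℕ.+ n)) X (λ _ → 0#) !X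
        (subst (λ k → suc k ≤ length X) (sym s+n≡d) d<|X|) (monic c) (Vec.replicate _ 0#)
        (All-map-∈ (λ {z} _ vanishes-at-z → ≡-trans (eval-monic (s ℕ.+ n) s+n≡d c z) vanishes-at-z) c-vanishes)
        (All.tabulate (λ {z} _ → eval-zero (suc (s ℕ.+ n)) z))

    G : ℕ → ℚ
    G r = ∑[ X ← subsetsOfSize r ] N n X

    G-few : ∀ r → r ≤ n → G r ≡ ℕtoℚ (q C r) * ℕtoℚ (q ℕ.^ (n ∸ r))
    G-few r r≤n = begin
      ∑[ X ← subsetsOfSize r ] N n X
        ≡⟨ ∑-cong-∈ (subsetsOfSize r) (λ X X∈ → let !X , |X|≡r = ∈-subsetsOfSize⁻ X∈ in
             ≡-trans (N-few X !X (subst (_≤ n) (sym |X|≡r) r≤n)) (cong (λ k → ℕtoℚ (q ℕ.^ (n ∸ k))) |X|≡r)) ⟩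
      ∑[ _ ← subsetsOfSize r ] ℕtoℚ (q ℕ.^ (n ∸ r))
        ≡⟨ ∑-const (subsetsOfSize r) _ ⟩
      ℕtoℚ (length (subsetsOfSize r)) * ℕtoℚ (q ℕ.^ (n ∸ r))
        ≡⟨ cong (_* ℕtoℚ (q ℕ.^ (n ∸ r))) (#subsetsOfSize r) ⟩
      ℕtoℚ (q C r) * ℕtoℚ (q ℕ.^ (n ∸ r)) ∎

    G-many : ∀ r → n < r → G r ≡ ℕtoℚ (χ d s a r)
    G-many r n<r = begin
      ∑[ X ← subsetsOfSize r ] N n X
        ≡⟨ ∑-cong-∈ (subsetsOfSize r) (λ X X∈ → let !X , |X|≡r = ∈-subsetsOfSize⁻ X∈ in
             N-many X !X (subst (n ≤_) (sym |X|≡r) (ℕ.<⇒≤ n<r))) ⟩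
      ∑[ X ← subsetsOfSize r ] when (vanishes? d s a X) 1ℚ
        ≡⟨ ∑-filter (vanishes? d s a) (subsetsOfSize r) _ ⟨
      ∑[ _ ← filter (vanishes? d s a) (subsetsOfSize r) ] 1ℚ
        ≡⟨ length≡∑1 (filter (vanishes? d s a) (subsetsOfSize r)) ⟨
      ℕtoℚ (χ d s a r) ∎

    G-tooMany : ∀ r → d < r → G r ≡ 0ℚ
    G-tooMany r d<r = ∑-vanishes (subsetsOfSize r) _ (λ X X∈ → let !X , |X|≡r = ∈-subsetsOfSize⁻ X∈ in
      N-tooMany X !X (subst (d <_) (sym |X|≡r) d<r))

    total : ℕ
    total = sum (map (λ b → valueSetSize (fb d s a b)) (allVecs m))

    level : Vec Carrier m → Carrier → List Carrier → ℚ
    level b v X = when (all? (λ x → fb d s a b x ≟F v) X) 1ℚ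

    alternating : Vec Carrier m → Carrier → ℚ
    alternating b v = ∑[ X ← sublists elements ] signQ (length X) * level b v X

    total≡q^n-∑signed-N : ℕtoℚ total ≡ ℕtoℚ (q ℕ.^ n) + - (∑[ X ← sublists elements ] signQ (length X) * N n X)
    total≡q^n-∑signed-N = begin
      ℕtoℚ total
        ≡⟨ ℕtoℚ-sum (allVecs m) _ ⟩
      ∑[ b ← allVecs m ] ℕtoℚ (valueSetSize (fb d s a b))
        ≡⟨ ∑-cong (allVecs m) (λ b → ≡-trans (valueSetSize≡∑ (fb d s a b)) (∑-cong elements (attained≡ b))) ⟩
      ∑[ b ← allVecs m ] ∑[ v ← elements ] (1ℚ + - alternating b v)
        ≡⟨ ∑-cong (allVecs m) (λ b → ∑-+-neg elements _ _) ⟩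
      ∑[ b ← allVecs m ] (∑[ v ← elements ] 1ℚ + - (∑[ v ← elements ] alternating b v))
        ≡⟨ ∑-+-neg (allVecs m) _ _ ⟩
      ∑[ b ← allVecs m ] ∑[ v ← elements ] 1ℚ + - (∑[ b ← allVecs m ] ∑[ v ← elements ] alternating b v)
        ≡⟨ cong₂ (λ u w → u + - w) #coefficients regroup ⟩
      ℕtoℚ (q ℕ.^ n) + - (∑[ X ← sublists elements ] signQ (length X) * N n X) ∎
      where
      attained≡ : ∀ b v → when (any? (λ x → fb d s a b x ≟F v) elements) 1ℚ ≡ 1ℚ + - alternating b v
      attained≡ b v = ≡-trans (identity _)
        (cong (λ w → 1ℚ + - w) (sym (inclusion-exclusion (λ x → fb d s a b x ≟F v) elements)))
        where
        identity : ∀ w → w ≡ 1ℚ + - (1ℚ + - w)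
        identity = solve-∀ ℚ-ring
      #coefficients : ∑[ b ← allVecs m ] ∑[ v ← elements ] 1ℚ ≡ ℕtoℚ (q ℕ.^ n)
      #coefficients = ≡-trans (sym (∑-allVecs-∷ʳ m (λ _ → 1ℚ)))
                              (≡-trans (∑-allVecs-1 (suc m)) (cong (λ k → ℕtoℚ (q ℕ.^ k)) (sym n≡1+m)))
      regroup : ∑[ b ← allVecs m ] ∑[ v ← elements ] alternating b v ≡ ∑[ X ← sublists elements ] signQ (length X) * N n X
      regroup = begin
        ∑[ b ← allVecs m ] ∑[ v ← elements ] ∑[ X ← sublists elements ] signQ (length X) * level b v X
          ≡⟨ ∑-cong (allVecs m) (λ b → ∑-comm elements (sublists elements) _) ⟩
        ∑[ b ← allVecs m ] ∑[ X ← sublists elements ] ∑[ v ← elements ] signQ (length X) * level b v X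
          ≡⟨ ∑-comm (allVecs m) (sublists elements) _ ⟩
        ∑[ X ← sublists elements ] ∑[ b ← allVecs m ] ∑[ v ← elements ] signQ (length X) * level b v X
          ≡⟨ ∑-cong (sublists elements) (λ X → ≡-trans
               (∑-cong (allVecs m) (λ b → ∑-*ˡ elements (signQ (length X)) _)) (∑-*ˡ (allVecs m) (signQ (length X)) _)) ⟩
        ∑[ X ← sublists elements ] signQ (length X) * (∑[ b ← allVecs m ] ∑[ v ← elements ] level b v X)
          ≡⟨ ∑-cong (sublists elements) (λ X → cong (signQ (length X) *_)
               (≡-trans (∑-level≡∑-zero m f X) (cong (λ k → N k X) (sym n≡1+m)))) ⟩
        ∑[ X ← sublists elements ] signQ (length X) * N n X ∎

    R₁ R₂ : ℚ
    R₁ = ∑[ r ← range 1 n ] signQ r * (ℕtoℚ (q C r) * ℕtoℚ (q ℕ.^ (n ∸ r)))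
    R₂ = ∑[ r ← range (suc n) (d ∸ n) ] signQ r * ℕtoℚ (χ d s a r)

    range-0-q : range 0 (suc q) ≡ 0 ∷ range 1 n ++ range (suc n) (d ∸ n) ++ range (suc d) (q ∸ d)
    range-0-q = cong (0 ∷_) (begin
      range 1 q
        ≡⟨ cong (range 1) q≡n+[[d∸n]+[q∸d]] ⟩
      range 1 (n ℕ.+ ((d ∸ n) ℕ.+ (q ∸ d)))
        ≡⟨ range-++ 1 n _ ⟩
      range 1 n ++ range (suc n) ((d ∸ n) ℕ.+ (q ∸ d))
        ≡⟨ cong (range 1 n ++_) (range-++ (suc n) (d ∸ n) (q ∸ d)) ⟩
      range 1 n ++ range (suc n) (d ∸ n) ++ range (suc n ℕ.+ (d ∸ n)) (q ∸ d)
        ≡⟨ cong (λ i → range 1 n ++ range (suc n) (d ∸ n) ++ range (suc i) (q ∸ d)) (ℕ.m+[n∸m]≡n n≤d) ⟩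
      range 1 n ++ range (suc n) (d ∸ n) ++ range (suc d) (q ∸ d) ∎)
      where
      q≡n+[[d∸n]+[q∸d]] : q ≡ n ℕ.+ ((d ∸ n) ℕ.+ (q ∸ d))
      q≡n+[[d∸n]+[q∸d]] = sym (≡-trans (sym (ℕ.+-assoc n (d ∸ n) (q ∸ d)))
        (≡-trans (cong (ℕ._+ (q ∸ d)) (ℕ.m+[n∸m]≡n n≤d)) (ℕ.m+[n∸m]≡n (ℕ.<⇒≤ d<q))))

    ∑signed-N≡q^n+R₁+R₂ : ∑[ X ← sublists elements ] signQ (length X) * N n X ≡ ℕtoℚ (q ℕ.^ n) + (R₁ + R₂)
    ∑signed-N≡q^n+R₁+R₂ = begin
      ∑[ X ← sublists elements ] signQ (length X) * N n X
        ≡⟨ ∑-bySize q (sublists elements) _ (λ X → sublists-length≤ elements) ⟩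
      ∑[ r ← range 0 (suc q) ] ∑[ X ← subsetsOfSize r ] signQ (length X) * N n X
        ≡⟨ ∑-cong (range 0 (suc q)) (λ r → ≡-trans
             (∑-cong-∈ (subsetsOfSize r) (λ X X∈ → cong (λ k → signQ k * N n X) (proj₂ (∈-subsetsOfSize⁻ X∈))))
             (∑-*ˡ (subsetsOfSize r) (signQ r) (N n))) ⟩
      ∑[ r ← range 0 (suc q) ] signQ r * G r
        ≡⟨ cong (λ rs → ∑ rs (λ r → signQ r * G r)) range-0-q ⟩
      signQ 0 * G 0 + ∑[ r ← range 1 n ++ range (suc n) (d ∸ n) ++ range (suc d) (q ∸ d) ] signQ r * G r
        ≡⟨ cong (signQ 0 * G 0 +_) (≡-trans (∑-++ (range 1 n) _ _)
             (cong (∑[ r ← range 1 n ] signQ r * G r +_) (∑-++ (range (suc n) (d ∸ n)) _ _))) ⟩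
      signQ 0 * G 0 + (∑[ r ← range 1 n ] signQ r * G r
                       + (∑[ r ← range (suc n) (d ∸ n) ] signQ r * G r + ∑[ r ← range (suc d) (q ∸ d) ] signQ r * G r))
        ≡⟨ cong₂ _+_ empty-set (cong₂ _+_ ≡R₁ (cong₂ _+_ ≡R₂ tooMany-vanish)) ⟩
      ℕtoℚ (q ℕ.^ n) + (R₁ + (R₂ + 0ℚ))
        ≡⟨ cong (λ w → ℕtoℚ (q ℕ.^ n) + (R₁ + w)) (ℚ.+-identityʳ R₂) ⟩
      ℕtoℚ (q ℕ.^ n) + (R₁ + R₂) ∎
      where
      empty-set : signQ 0 * G 0 ≡ ℕtoℚ (q ℕ.^ n)
      empty-set = ≡-trans (ℚ.*-identityˡ (G 0)) (≡-trans (G-few 0 ℕ.z≤n) (ℚ.*-identityˡ _))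
      ≡R₁ : ∑[ r ← range 1 n ] signQ r * G r ≡ R₁
      ≡R₁ = ∑-cong-∈ (range 1 n) (λ r r∈ → cong (signQ r *_) (G-few r (ℕ.≤-pred (proj₂ (∈-range⁻ r∈)))))
      ≡R₂ : ∑[ r ← range (suc n) (d ∸ n) ] signQ r * G r ≡ R₂
      ≡R₂ = ∑-cong-∈ (range (suc n) (d ∸ n)) (λ r r∈ → cong (signQ r *_) (G-many r (proj₁ (∈-range⁻ r∈))))
      tooMany-vanish : ∑[ r ← range (suc d) (q ∸ d) ] signQ r * G r ≡ 0ℚ
      tooMany-vanish = ∑-vanishes (range (suc d) (q ∸ d)) _ (λ r r∈ →
        ≡-trans (cong (signQ r *_) (G-tooMany r (proj₁ (∈-range⁻ r∈)))) (ℚ.*-zeroʳ (signQ r)))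

    total≡-R₁-R₂ : ℕtoℚ total ≡ - R₁ + - R₂
    total≡-R₁-R₂ = begin
      ℕtoℚ total                                                    ≡⟨ total≡q^n-∑signed-N ⟩
      ℕtoℚ (q ℕ.^ n) + - (∑[ X ← sublists elements ] signQ (length X) * N n X)
        ≡⟨ cong (λ w → ℕtoℚ (q ℕ.^ n) + - w) ∑signed-N≡q^n+R₁+R₂ ⟩
      ℕtoℚ (q ℕ.^ n) + - (ℕtoℚ (q ℕ.^ n) + (R₁ + R₂))              ≡⟨ cancel (ℕtoℚ (q ℕ.^ n)) R₁ R₂ ⟩
      - R₁ + - R₂                                                   ∎
      where
      cancel : ∀ x y z → x + - (x + (y + z)) ≡ - y + - z
      cancel = solve-∀ ℚ-ring

    q⁻ᵐ*-R₁ : invPowQ m * - R₁ ≡ ∑[ r ← range 1 n ] signQ (r ∸ 1) * ℕtoℚ (q C r) * invPowQ (r ∸ 1)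
    q⁻ᵐ*-R₁ = begin
      invPowQ m * - R₁
        ≡⟨ cong (invPowQ m *_) (∑-neg (range 1 n) _) ⟨
      invPowQ m * (∑[ r ← range 1 n ] - (signQ r * (ℕtoℚ (q C r) * ℕtoℚ (q ℕ.^ (n ∸ r)))))
        ≡⟨ ∑-*ˡ (range 1 n) (invPowQ m) _ ⟨
      ∑[ r ← range 1 n ] invPowQ m * - (signQ r * (ℕtoℚ (q C r) * ℕtoℚ (q ℕ.^ (n ∸ r))))
        ≡⟨ ∑-cong-∈ (range 1 n) (λ r r∈ → term r (∈-range⁻ r∈)) ⟩
      ∑[ r ← range 1 n ] signQ (r ∸ 1) * ℕtoℚ (q C r) * invPowQ (r ∸ 1) ∎
      where
      identity : ∀ i u c p → i * (u * (c * p)) ≡ u * c * (i * p)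
      identity = solve-∀ ℚ-ring
      term : ∀ r → 1 ≤ r × r < 1 ℕ.+ n → invPowQ m * - (signQ r * (ℕtoℚ (q C r) * ℕtoℚ (q ℕ.^ (n ∸ r))))
                                         ≡ signQ (r ∸ 1) * ℕtoℚ (q C r) * invPowQ (r ∸ 1)
      term (suc r) (_ , ℕ.s≤s r<n) = begin
        invPowQ m * - (signQ (suc r) * (ℕtoℚ (q C suc r) * ℕtoℚ (q ℕ.^ (n ∸ suc r))))
          ≡⟨ cong (invPowQ m *_) (-signQ[1+r]*x≡signQ[r]*x r _) ⟩
        invPowQ m * (signQ r * (ℕtoℚ (q C suc r) * ℕtoℚ (q ℕ.^ (n ∸ suc r))))
          ≡⟨ identity (invPowQ m) (signQ r) _ _ ⟩
        signQ r * ℕtoℚ (q C suc r) * (invPowQ m * ℕtoℚ (q ℕ.^ (n ∸ suc r)))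
          ≡⟨ cong (λ k → signQ r * ℕtoℚ (q C suc r) * (invPowQ k * ℕtoℚ (q ℕ.^ (n ∸ suc r)))) m≡r+[n∸[1+r]] ⟩
        signQ r * ℕtoℚ (q C suc r) * (invPowQ (r ℕ.+ (n ∸ suc r)) * ℕtoℚ (q ℕ.^ (n ∸ suc r)))
          ≡⟨ cong (signQ r * ℕtoℚ (q C suc r) *_) (invPowQ-+-* r (n ∸ suc r)) ⟩
        signQ r * ℕtoℚ (q C suc r) * invPowQ r ∎
        where
        m≡r+[n∸[1+r]] : m ≡ r ℕ.+ (n ∸ suc r)
        m≡r+[n∸[1+r]] = sym (≡-trans (cong (r ℕ.+_) (sym (ℕ.∸-+-assoc n 1 r)))
                                     (ℕ.m+[n∸m]≡n (ℕ.≤-pred (subst (suc r ≤_) n≡1+m r<n))))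

    -R₂ : - R₂ ≡ ∑[ r ← range (suc n) (d ∸ n) ] signQ (r ∸ 1) * ℕtoℚ (χ d s a r)
    -R₂ = ≡-trans (sym (∑-neg (range (suc n) (d ∸ n)) _))
                  (∑-cong-∈ (range (suc n) (d ∸ n)) (λ r r∈ → term r (∈-range⁻ r∈)))
      where
      term : ∀ r → suc n ≤ r × r < suc n ℕ.+ (d ∸ n) →
             - (signQ r * ℕtoℚ (χ d s a r)) ≡ signQ (r ∸ 1) * ℕtoℚ (χ d s a r)
      term (suc r) _ = -signQ[1+r]*x≡signQ[r]*x r _

theorem2p1 : (F : FiniteField) (s d : ℕ) →
    d < FiniteField.q F → 1 ≤ s → s ≤ d ∸ 2 →
    (a : Vec (FiniteField.Carrier F) s) →
    FiniteField.avgValueSet F d s a ≡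
      sumFromTo 1 (d ∸ s)
        (λ r → signQ (r ∸ 1) * ℕtoℚ (FiniteField.q F C r) * FiniteField.invPowQ F (r ∸ 1))
      + FiniteField.invPowQ F (d ∸ s ∸ 1)
        * sumFromTo (suc (d ∸ s)) d
            (λ r → signQ (r ∸ 1) * ℕtoℚ (FiniteField.χ F d s a r))
theorem2p1 F s d d<q 1≤s s≤d∸2 a = begin
  q⁻ᵐ * ℕtoℚ total
    ≡⟨ cong (q⁻ᵐ *_) total≡-R₁-R₂ ⟩
  q⁻ᵐ * (- R₁ + - R₂)
    ≡⟨ ℚ.*-distribˡ-+ q⁻ᵐ (- R₁) (- R₂) ⟩
  q⁻ᵐ * - R₁ + q⁻ᵐ * - R₂
    ≡⟨ cong₂ (λ u w → u + q⁻ᵐ * w) q⁻ᵐ*-R₁ -R₂ ⟩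
  ∑[ r ← range 1 n ] signQ (r ∸ 1) * ℕtoℚ (q C r) * invPowQ (r ∸ 1)
    + q⁻ᵐ * (∑[ r ← range (suc n) (d ∸ n) ] signQ (r ∸ 1) * ℕtoℚ (χ d s a r))
    ≡⟨ cong₂ (λ u w → u + q⁻ᵐ * w) (sumFromTo≡∑range 1 n _) (sumFromTo≡∑range (suc n) d _) ⟨
  sumFromTo 1 n (λ r → signQ (r ∸ 1) * ℕtoℚ (q C r) * invPowQ (r ∸ 1))
    + q⁻ᵐ * sumFromTo (suc n) d (λ r → signQ (r ∸ 1) * ℕtoℚ (χ d s a r)) ∎
  where
  open FiniteField F using (q; invPowQ; χ)
  open ValueSetAverage F d s d<q 1≤s s≤d∸2 a
  q⁻ᵐ = invPowQ m
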